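{- Let $d \ge 3$ be odd and $k$ even. Let $T$ be the $d\times k^2$ table whose first $d-1$ rows are each equal to $(1^k\,2^k\cdots k^k)$ (i.e. $k$ ones, then $k$ twos, ..., then $k$ copies of $k$) and whose last row is $(1\,2\,\cdots\,k)$ repeated $k$ times. Then $\Delta_T(I_k) \neq 0$ if and only if $AT(k)\neq0$. In particular, if $AT(k) \ne 0$ then $\Delta_T$ is a nonzero $\mathrm{SL}(k)^{\times d}$-invariant homogeneous polynomial of degree $k^2$ on $(\mathbb{C}^k)^{\otimes d}$.
   Context: Tensors $X\in(\mathbb{C}^k)^{\otimes d}$ are hypermatrices $(X_{i_1,\ldots,i_d})$. $I_k$ is the unit tensor: $(I_k)_{i_1,\ldots,i_d}=1$ if $i_1=\cdots=i_d$ and $0$ otherwise. For a $d\times M$ table $T$ (here $M=k^2$) in which each row contains each element of $[M/k]$ exactly $k$ times, and $\sigma:[M]\to[k]$, let $\mathrm{sgn}_{T_i}(\sigma) := \prod_b \mathrm{sgn}(\sigma(j_{b,1}),\ldots,\sigma(j_{b,k}))$, the product over values $b$, with $j_{b,1}<\cdots<j_{b,k}$ the positions in row $i$ where $T_{ij}=b$, and $\mathrm{sgn}$ of a sequence being its sign if it is a permutation of $[k]$ and $0$ otherwise. $\Delta_T(X):=\sum_{\sigma_1,\ldots,\sigma_d:[M]\to[k]}\prod_i\mathrm{sgn}_{T_i}(\sigma_i)\prod_{j=1}^M X_{\sigma_1(j),\ldots,\sigma_d(j)}$. A Latin square of length $k$ is a $k\times k$ matrix each of whose rows and columns is a permutation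 of $[k]$; its sign is the product of the signs of all its rows and columns; the Alon--Tarsi number $AT(k)$ is the sum of the signs of all Latin squares of length $k$. -}

module Defs where

open import Data.Nat as ℕ using (ℕ; zero; suc)
open import Data.Fin as Fin using (Fin; toℕ; quotient; remainder; _<?_)
open import Data.Fin.Properties using (_≟_)
open import Data.Integer as ℤ using (ℤ; +_; -_)
open import Data.List as List using (List; []; _∷_; map; filter; length; concatMap; allFin; foldr)
open import Data.Bool using (Bool; true; false; _∧_; if_then_else_)
open import Relation.Nullary.Decidable using (⌊_⌋; does)

allB : {A : Set} → (A → Bool) → List A → Bool
allB p [] = true
allB p (x ∷ xs) = p x ∧ allB p xs

sumℤ : List ℤ → ℤ
sumℤ = foldr ℤ._+_ (+ 0)

prodℤ : List ℤ → ℤ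
prodℤ = foldr ℤ._*_ (+ 1)

allFns : {A : Set} → (n : ℕ) → List A → List (Fin n → A)
allFns zero    xs = (λ ()) ∷ []
allFns (suc n) xs =
  concatMap (λ a → map (λ f → λ { Fin.zero → a ; (Fin.suc i) → f i }) (allFns n xs)) xs

sumFns : (n k : ℕ) → ((Fin n → Fin k) → ℤ) → ℤ
sumFns n k F = sumℤ (map F (allFns n (allFin k)))

distinctB : {k : ℕ} → List (Fin k) → Bool
distinctB [] = true
distinctB (x ∷ xs) = allB (λ y → Data.Bool.not ⌊ x ≟ y ⌋) xs ∧ distinctB xs
  where import Data.Bool

inversions : {k : ℕ} → List (Fin k) → ℕ
inversions [] = 0
inversions (x ∷ xs) = length (filter (λ y → y <? x) xs) ℕ.+ inversions xs

negOnePow : ℕ → ℤ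
negOnePow zero = + 1
negOnePow (suc n) = - negOnePow n

sgnSeq : (k : ℕ) → List (Fin k) → ℤ
sgnSeq k xs =
  if ⌊ length xs ℕ.≟ k ⌋ ∧ distinctB xs then negOnePow (inversions xs) else + 0

Table : ℕ → ℕ → ℕ → Set
Table d M m = Fin d → Fin M → Fin m

positions : {M m : ℕ} → (Fin M → Fin m) → Fin m → List (Fin M)
positions {M} r b = filter (λ j → r j ≟ b) (allFin M)

sgnRow : {M m : ℕ} → (k : ℕ) → (Fin M → Fin m) → (Fin M → Fin k) → ℤ
sgnRow {M} {m} k r σ = prodℤ (map (λ b → sgnSeq k (map σ (positions r b))) (allFin m))

-- tensors in (ℤ^k)^{⊗d} as hypermatrices
Tensor : ℕ → ℕ → Set
Tensor d k = (Fin d → Fin k) → ℤ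

unitTensor : (d k : ℕ) → Tensor d k
unitTensor zero    k idx = + 1
unitTensor (suc d) k idx =
  if allB (λ i → ⌊ idx i ≟ idx Fin.zero ⌋) (allFin (suc d)) then + 1 else + 0

Δ : {d M m : ℕ} → (k : ℕ) → Table d M m → Tensor d k → ℤ
Δ {d} {M} {m} k T X =
  sumℤ (map (λ σ → prodℤ (map (λ i → sgnRow k (T i) (σ i)) (allFin d))
                   ℤ.* prodℤ (map (λ j → X (λ i → σ i j)) (allFin M)))
            (allFns d (allFns M (allFin k))))

isLatinB : (k : ℕ) → (Fin k → Fin k → Fin k) → Bool
isLatinB k L =
  allB (λ i → distinctB (map (λ j → L i j) (allFin k))) (allFin k)
  ∧ allB (λ j → distinctB (map (λ i → L i j) (allFin k))) (allFin k)

latinSign : (k : ℕ) → (Fin k → Fin k → Fin k) → ℤ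
latinSign k L =
  prodℤ (map (λ i → sgnSeq k (map (λ j → L i j) (allFin k))) (allFin k))
  ℤ.* prodℤ (map (λ j → sgnSeq k (map (λ i → L i j) (allFin k))) (allFin k))

AT : ℕ → ℤ
AT k = sumℤ (map (latinSign k)
              (filter (λ L → isLatinB k L Data.Bool.≟ true)
                      (allFns k (allFns k (allFin k)))))
  where import Data.Bool

-- the table of Proposition 7.1 (0-indexed): rows 0..d-2 are (0^k 1^k … (k-1)^k),
-- the last row (index d-1) is (0 1 … k-1) repeated k times
tableT : (d k : ℕ) → Table d (k ℕ.* k) k
tableT d k i j = if ⌊ suc (toℕ i) ℕ.≟ d ⌋ then remainder {k} k j else quotient {k} k j

{-# OPTIONS --safe #-}
-- Only the diagonal terms σ₁ = ⋯ = σ_d of Δ_T(I_k) survive. Reading σ : [k²] → [k] as a k × k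
-- square L, the first d − 1 rows of T contribute the product of the row signs of L and the last
-- row the product of its column signs; for odd d this makes Δ_T(I_k) the sum over all squares L
-- of (row sign of L)² · (column sign of L). Replacing every permutation row of L by its inverse
-- is an involution of all squares; it keeps the row signs, and its image has permutation columns
-- exactly when L is Latin. In that case a double count of inversions over pairs of cells shows
-- that the column sign of the image is (−1)^(K²) sgn(L), where K = k(k − 1)/2.
-- Hence Δ_T(I_k) = (−1)^(K²) AT(k), for every k.
module Submission where

open import Defs
import Data.Integer.Properties as ℤP
import Data.Nat.Properties as ℕP
open import Algebra.Properties.CommutativeSemigroup ℤP.+-commutativeSemigroup using () renaming (interchange to +-interchange)
open import Algebra.Properties.CommutativeSemigroup ℕP.*-commutativeSemigroup using () renaming (x∙yz≈y∙xz to *-x∙yz≈y∙xz)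
open import Algebra.Properties.Semiring.Sum ℕP.+-*-semiring
  using (sum-syntax; sum-cong-≗; sum-replicate-zero; ∑-permute; ∑-comm; ∑-distrib-+; *-distribˡ-sum; *-distribʳ-sum)
open import Data.Bool as Bool using (Bool; true; false; _∧_; if_then_else_; not)
open import Data.Empty using (⊥-elim)
open import Data.Fin as Fin using (Fin; zero; suc; punchOut)
open import Data.Fin.Permutation using (permutation)
open import Data.Fin.Properties as Fin using (all?; any?; ∀-cons; ≡-decSetoid; punchOut-injective; injective⇒≤)
open import Data.Integer as ℤ using (ℤ; +_; -_; _^_)
open import Data.List as List using (List; []; _∷_; map; allFin; concatMap; tabulate; filter; _++_)
import Data.List.Properties as List
import Data.List.Relation.Unary.All as All
open import Data.Nat as ℕ using (ℕ; _≥_)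
open import Data.Nat.Divisibility using (_∣_; _∣0; ∣-refl; ∣m∣n⇒∣m+n)
open import Data.Nat.Solver using (module +-*-Solver)
open import Data.Product using (∃; _×_; _,_; proj₁; proj₂)
open import Data.Sum using ([_,_]′)
open import Data.Vec.Functional.Relation.Binary.Pointwise.Properties as Pointwise using ()
open import Function using (_∘_; _$_; id; Congruent; Injective; Inverse; StrictlyInverseˡ; StrictlyInverseʳ; mk⇔)
open import Function.Consequences.Setoid using (strictlyInverseˡ⇒inverseˡ; strictlyInverseʳ⇒inverseʳ)
open import Level using (0ℓ)
open import Relation.Binary.Bundles using (DecSetoid; Setoid)
open import Relation.Binary.Definitions using (tri<; tri≈; tri>)
open import Relation.Binary.PropositionalEquality
open import Relation.Nullary using (¬_)
open import Relation.Nullary.Decidable using (Dec; yes; no; does; ⌊_⌋; isYes≗does; dec-true; dec-false; does-⇔)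
open import Relation.Unary using (Pred; Decidable)

private variable
  A B : Set
  n k : ℕ

map-allFin-suc : (f : Fin (ℕ.suc n) → A) → map f (allFin (ℕ.suc n)) ≡ f zero ∷ map (f ∘ suc) (allFin n)
map-allFin-suc {n} f = begin
  map f (allFin (ℕ.suc n))    ≡⟨ List.map-tabulate id f ⟩
  tabulate f                  ≡⟨ cong (f zero ∷_) (List.map-tabulate id (f ∘ suc)) ⟨
  f zero ∷ map (f ∘ suc) (allFin n) ∎
  where open ≡-Reasoning

allFin-suc : allFin (ℕ.suc n) ≡ zero ∷ map suc (allFin n)
allFin-suc {n} = cong (zero ∷_) (sym (List.map-tabulate id suc))

allB-map : (p : B → Bool) (f : A → B) (xs : List A) → allB p (map f xs) ≡ allB (p ∘ f) xs
allB-map p f [] = refl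
allB-map p f (x ∷ xs) = cong (p (f x) ∧_) (allB-map p f xs)

allB-cong : {p q : A → Bool} → (∀ x → p x ≡ q x) → (xs : List A) → allB p xs ≡ allB q xs
allB-cong p≗q [] = refl
allB-cong p≗q (x ∷ xs) = cong₂ _∧_ (p≗q x) (allB-cong p≗q xs)

allB-allFin-suc : (p : Fin (ℕ.suc n) → Bool) → allB p (allFin (ℕ.suc n)) ≡ p zero ∧ allB (p ∘ suc) (allFin n)
allB-allFin-suc {n} p = trans (cong (allB p) allFin-suc) (cong (p zero ∧_) (allB-map p suc (allFin n)))

∧-true⁻ : ∀ {a b} → a ∧ b ≡ true → a ≡ true × b ≡ true
∧-true⁻ {true} {true} _ = refl , refl

allB-allFin⁻ : (p : Fin n → Bool) → allB p (allFin n) ≡ true → ∀ i → p i ≡ true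
allB-allFin⁻ {ℕ.suc n} p all-p i with ∧-true⁻ {p zero} (trans (sym (allB-allFin-suc p)) all-p)
allB-allFin⁻ {ℕ.suc n} p all-p zero    | p0 , _ = p0
allB-allFin⁻ {ℕ.suc n} p all-p (suc i) | _ , ps = allB-allFin⁻ (p ∘ suc) ps i

allB-allFin⁺ : (p : Fin n → Bool) → (∀ i → p i ≡ true) → allB p (allFin n) ≡ true
allB-allFin⁺ {ℕ.zero} p all-p = refl
allB-allFin⁺ {ℕ.suc n} p all-p =
  trans (allB-allFin-suc p) (cong₂ _∧_ (all-p zero) (allB-allFin⁺ (p ∘ suc) (all-p ∘ suc)))

allB-does-all? : ∀ {P : Fin n → Set} (P? : ∀ i → Dec (P i)) → allB (does ∘ P?) (allFin n) ≡ does (all? P?)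
allB-does-all? {ℕ.zero} P? = refl
allB-does-all? {ℕ.suc n} P? =
  trans (allB-allFin-suc (does ∘ P?)) (cong (does (P? zero) ∧_) (allB-does-all? (P? ∘ suc)))

allB-isYes : ∀ {P : Fin n → Set} (P? : ∀ i → Dec (P i)) → allB (λ i → ⌊ P? i ⌋) (allFin n) ≡ does (all? P?)
allB-isYes P? = trans (allB-cong (λ i → isYes≗does (P? i)) (allFin _)) (allB-does-all? P?)

bool-≡ : ∀ {a b} → (a ≡ true → b ≡ true) → (b ≡ true → a ≡ true) → a ≡ b
bool-≡ {true}  {_}     a⇒b _   = sym (a⇒b refl)
bool-≡ {false} {true}  _   b⇒a = b⇒a refl
bool-≡ {false} {false} _   _   = refl

not-isYes⇒¬ : ∀ {P : Set} (P? : Dec P) → not ⌊ P? ⌋ ≡ true → ¬ P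
not-isYes⇒¬ (no ¬p) _ = ¬p

¬⇒not-isYes : ∀ {P : Set} (P? : Dec P) → ¬ P → not ⌊ P? ⌋ ≡ true
¬⇒not-isYes (yes p) ¬p = ⊥-elim (¬p p)
¬⇒not-isYes (no _)  _  = refl

𝟙 : Bool → ℤ
𝟙 b = if b then + 1 else + 0

𝟙-∧ : ∀ a b → 𝟙 (a ∧ b) ≡ 𝟙 a ℤ.* 𝟙 b
𝟙-∧ true true = refl
𝟙-∧ true false = refl
𝟙-∧ false b = sym (ℤP.*-zeroˡ (𝟙 b))

prodℤ-𝟙 : (p : A → Bool) (xs : List A) → prodℤ (map (𝟙 ∘ p) xs) ≡ 𝟙 (allB p xs)
prodℤ-𝟙 p [] = refl
prodℤ-𝟙 p (x ∷ xs) = trans (cong (𝟙 (p x) ℤ.*_) (prodℤ-𝟙 p xs)) (sym (𝟙-∧ (p x) (allB p xs)))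

sumℤ-cong : {f g : A → ℤ} → (∀ x → f x ≡ g x) → (xs : List A) → sumℤ (map f xs) ≡ sumℤ (map g xs)
sumℤ-cong f≗g xs = cong sumℤ (List.map-cong f≗g xs)

prodℤ-cong : {f g : A → ℤ} → (∀ x → f x ≡ g x) → (xs : List A) → prodℤ (map f xs) ≡ prodℤ (map g xs)
prodℤ-cong f≗g xs = cong prodℤ (List.map-cong f≗g xs)

sumℤ-++ : (xs ys : List ℤ) → sumℤ (xs ++ ys) ≡ sumℤ xs ℤ.+ sumℤ ys
sumℤ-++ [] ys = sym (ℤP.+-identityˡ (sumℤ ys))
sumℤ-++ (x ∷ xs) ys = trans (cong (ℤ._+_ x) (sumℤ-++ xs ys)) (sym (ℤP.+-assoc x (sumℤ xs) (sumℤ ys)))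

sumℤ-concatMap : (F : B → ℤ) (g : A → List B) (xs : List A) →
  sumℤ (map F (concatMap g xs)) ≡ sumℤ (map (λ x → sumℤ (map F (g x))) xs)
sumℤ-concatMap F g [] = refl
sumℤ-concatMap F g (x ∷ xs) = begin
  sumℤ (map F (g x ++ concatMap g xs))                  ≡⟨ cong sumℤ (List.map-++ F (g x) (concatMap g xs)) ⟩
  sumℤ (map F (g x) ++ map F (concatMap g xs))          ≡⟨ sumℤ-++ (map F (g x)) _ ⟩
  sumℤ (map F (g x)) ℤ.+ sumℤ (map F (concatMap g xs)) ≡⟨ cong (ℤ._+_ (sumℤ (map F (g x)))) (sumℤ-concatMap F g xs) ⟩
  sumℤ (map F (g x)) ℤ.+ sumℤ (map (λ y → sumℤ (map F (g y))) xs) ∎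
  where open ≡-Reasoning

sumℤ-zero : (xs : List A) → sumℤ (map (λ _ → + 0) xs) ≡ + 0
sumℤ-zero [] = refl
sumℤ-zero (x ∷ xs) = trans (ℤP.+-identityˡ _) (sumℤ-zero xs)

sumℤ-*ˡ : (c : ℤ) (f : A → ℤ) (xs : List A) → sumℤ (map (λ x → c ℤ.* f x) xs) ≡ c ℤ.* sumℤ (map f xs)
sumℤ-*ˡ c f [] = sym (ℤP.*-zeroʳ c)
sumℤ-*ˡ c f (x ∷ xs) = trans (cong (ℤ._+_ (c ℤ.* f x)) (sumℤ-*ˡ c f xs)) (sym (ℤP.*-distribˡ-+ c (f x) _))

sumℤ-*ʳ : (c : ℤ) (f : A → ℤ) (xs : List A) → sumℤ (map (λ x → f x ℤ.* c) xs) ≡ sumℤ (map f xs) ℤ.* c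
sumℤ-*ʳ c f xs = begin
  sumℤ (map (λ x → f x ℤ.* c) xs) ≡⟨ sumℤ-cong (λ x → ℤP.*-comm (f x) c) xs ⟩
  sumℤ (map (λ x → c ℤ.* f x) xs) ≡⟨ sumℤ-*ˡ c f xs ⟩
  c ℤ.* sumℤ (map f xs)           ≡⟨ ℤP.*-comm c _ ⟩
  sumℤ (map f xs) ℤ.* c           ∎
  where open ≡-Reasoning

sumℤ-+ : (f g : A → ℤ) (xs : List A) → sumℤ (map (λ x → f x ℤ.+ g x) xs) ≡ sumℤ (map f xs) ℤ.+ sumℤ (map g xs)
sumℤ-+ f g [] = refl
sumℤ-+ f g (x ∷ xs) = trans (cong (ℤ._+_ (f x ℤ.+ g x)) (sumℤ-+ f g xs)) (+-interchange (f x) (g x) _ _)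

sumℤ-comm : (F : A → B → ℤ) (xs : List A) (ys : List B) →
  sumℤ (map (λ x → sumℤ (map (F x) ys)) xs) ≡ sumℤ (map (λ y → sumℤ (map (λ x → F x y) xs)) ys)
sumℤ-comm F [] ys = sym (sumℤ-zero ys)
sumℤ-comm F (x ∷ xs) ys =
  trans (cong (ℤ._+_ (sumℤ (map (F x) ys))) (sumℤ-comm F xs ys)) (sym (sumℤ-+ (F x) _ ys))

sumℤ-concatMap-map : ∀ {D : Set} (F : B → ℤ) (c : A → D → B) (ys : List D) (xs : List A) →
  sumℤ (map F (concatMap (λ x → map (c x) ys) xs)) ≡ sumℤ (map (λ x → sumℤ (map (F ∘ c x) ys)) xs)
sumℤ-concatMap-map F c ys xs =
  trans (sumℤ-concatMap F (λ x → map (c x) ys) xs) (sumℤ-cong (λ x → cong sumℤ (sym (List.map-∘ ys))) xs)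

sumℤ-filter-true : (p : A → Bool) (F : A → ℤ) (xs : List A) →
  sumℤ (map F (List.filter (λ x → p x Bool.≟ true) xs)) ≡ sumℤ (map (λ x → 𝟙 (p x) ℤ.* F x) xs)
sumℤ-filter-true p F [] = refl
sumℤ-filter-true p F (x ∷ xs) with p x
... | true  = cong₂ ℤ._+_ (sym (ℤP.*-identityˡ (F x))) (sumℤ-filter-true p F xs)
... | false = trans (sumℤ-filter-true p F xs) (sym (ℤP.+-identityˡ _))

-- Sums over enumerated setoids

-- Without function extensionality, sums over all functions can only be reindexed along maps that
-- are inverse up to pointwise equality; hence elements are listed up to a decidable setoid.
record Enumeration (S : DecSetoid 0ℓ 0ℓ) : Set where
  open DecSetoid S using (Carrier; _≟_)
  field
    elements : List Carrier
    count-≈ : ∀ x → sumℤ (map (λ y → 𝟙 (does (y ≟ x))) elements) ≡ + 1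

open Enumeration

module _ {S : DecSetoid 0ℓ 0ℓ} (E : Enumeration S) where
  open DecSetoid S using (Carrier; _≈_; _≟_)

  sum-𝟙-≈-* : {G : Carrier → ℤ} → Congruent _≈_ _≡_ G → ∀ x →
    sumℤ (map (λ y → 𝟙 (does (y ≟ x)) ℤ.* G y) (elements E)) ≡ G x
  sum-𝟙-≈-* {G} G-cong x = begin
    sumℤ (map (λ y → 𝟙 (does (y ≟ x)) ℤ.* G y) (elements E)) ≡⟨ sumℤ-cong 𝟙-≈-* (elements E) ⟩
    sumℤ (map (λ y → 𝟙 (does (y ≟ x)) ℤ.* G x) (elements E)) ≡⟨ sumℤ-*ʳ (G x) _ (elements E) ⟩
    sumℤ (map (λ y → 𝟙 (does (y ≟ x))) (elements E)) ℤ.* G x ≡⟨ cong (ℤ._* G x) (count-≈ E x) ⟩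
    + 1 ℤ.* G x                                               ≡⟨ ℤP.*-identityˡ (G x) ⟩
    G x                                                       ∎
    where
    open ≡-Reasoning
    𝟙-≈-* : ∀ y → 𝟙 (does (y ≟ x)) ℤ.* G y ≡ 𝟙 (does (y ≟ x)) ℤ.* G x
    𝟙-≈-* y with y ≟ x
    ... | yes y≈x = cong (ℤ._*_ (+ 1)) (G-cong y≈x)
    ... | no _ = refl

module _ {S₁ S₂ : Setoid 0ℓ 0ℓ} where
  open Setoid S₁ using () renaming (Carrier to A₁; _≈_ to _≈₁_)
  open Setoid S₂ using () renaming (Carrier to A₂; _≈_ to _≈₂_)

  strictInverse : (to : A₁ → A₂) (from : A₂ → A₁) → Congruent _≈₁_ _≈₂_ to → Congruent _≈₂_ _≈₁_ from →
    StrictlyInverseˡ _≈₂_ to from → StrictlyInverseʳ _≈₁_ to from → Inverse S₁ S₂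
  strictInverse to from to-cong from-cong invˡ invʳ = record
    { to = to ; from = from ; to-cong = to-cong ; from-cong = from-cong
    ; inverse = strictlyInverseˡ⇒inverseˡ S₁ S₂ to-cong invˡ , strictlyInverseʳ⇒inverseʳ S₁ S₂ from-cong invʳ }

module _ {S₁ S₂ : DecSetoid 0ℓ 0ℓ} (E₁ : Enumeration S₁) (E₂ : Enumeration S₂) where
  open DecSetoid S₁ using () renaming (Carrier to A₁; _≟_ to _≟₁_; sym to sym₁)
  open DecSetoid S₂ using () renaming (Carrier to A₂; _≈_ to _≈₂_; _≟_ to _≟₂_; sym to sym₂)

  sum-reindex : (f : Inverse (DecSetoid.setoid S₁) (DecSetoid.setoid S₂)) {G : A₂ → ℤ} → Congruent _≈₂_ _≡_ G →
    sumℤ (map (G ∘ Inverse.to f) (elements E₁)) ≡ sumℤ (map G (elements E₂))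
  sum-reindex f {G} G-cong = begin
    Σ₁ (λ a → G (to a))
      ≡⟨ sumℤ-cong (λ a → sum-𝟙-≈-* E₂ G-cong (to a)) (elements E₁) ⟨
    Σ₁ (λ a → Σ₂ (λ b → 𝟙 (does (b ≟₂ to a)) ℤ.* G b))
      ≡⟨ sumℤ-comm (λ a b → 𝟙 (does (b ≟₂ to a)) ℤ.* G b) (elements E₁) (elements E₂) ⟩
    Σ₂ (λ b → Σ₁ (λ a → 𝟙 (does (b ≟₂ to a)) ℤ.* G b))
      ≡⟨ sumℤ-cong (λ b → sumℤ-cong (λ a → cong (λ t → 𝟙 t ℤ.* G b) (≈-to⇔≈-from a b)) (elements E₁)) (elements E₂) ⟩
    Σ₂ (λ b → Σ₁ (λ a → 𝟙 (does (a ≟₁ from b)) ℤ.* G b))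
      ≡⟨ sumℤ-cong (λ b → sum-𝟙-≈-* E₁ (λ _ → refl) (from b)) (elements E₂) ⟩
    Σ₂ G ∎
    where
    open ≡-Reasoning
    open Inverse f
    Σ₁ : (A₁ → ℤ) → ℤ
    Σ₁ F = sumℤ (map F (elements E₁))
    Σ₂ : (A₂ → ℤ) → ℤ
    Σ₂ F = sumℤ (map F (elements E₂))
    ≈-to⇔≈-from : ∀ a b → does (b ≟₂ to a) ≡ does (a ≟₁ from b)
    ≈-to⇔≈-from a b = does-⇔ (mk⇔ (sym₁ ∘ inverseʳ) (sym₂ ∘ inverseˡ)) (b ≟₂ to a) (a ≟₁ from b)

finEnumeration : ∀ k → Enumeration (≡-decSetoid k)
finEnumeration k = record { elements = allFin k ; count-≈ = count }
  where
  count : ∀ {k} (x : Fin k) → sumℤ (map (λ y → 𝟙 (does (y Fin.≟ x))) (allFin k)) ≡ + 1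
  count {ℕ.suc k} zero = begin
    sumℤ (map (λ y → 𝟙 (does (y Fin.≟ zero))) (allFin (ℕ.suc k)))
      ≡⟨ cong sumℤ (map-allFin-suc {n = k} (λ y → 𝟙 (does (y Fin.≟ zero)))) ⟩
    + 1 ℤ.+ sumℤ (map (λ _ → + 0) (allFin k))
      ≡⟨ cong (ℤ._+_ (+ 1)) (sumℤ-zero (allFin k)) ⟩
    + 1 ∎
    where open ≡-Reasoning
  count {ℕ.suc k} (suc x) = begin
    sumℤ (map (λ y → 𝟙 (does (y Fin.≟ suc x))) (allFin (ℕ.suc k)))
      ≡⟨ cong sumℤ (map-allFin-suc {n = k} (λ y → 𝟙 (does (y Fin.≟ suc x)))) ⟩
    + 0 ℤ.+ sumℤ (map (λ y → 𝟙 (does (y Fin.≟ x))) (allFin k))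
      ≡⟨ ℤP.+-identityˡ _ ⟩
    sumℤ (map (λ y → 𝟙 (does (y Fin.≟ x))) (allFin k))
      ≡⟨ count x ⟩
    + 1 ∎
    where open ≡-Reasoning

fnEnumeration : ∀ {S} n → Enumeration S → Enumeration (Pointwise.decSetoid S n)
fnEnumeration {S} n E = record { elements = allFns n (elements E) ; count-≈ = count n }
  where
  open DecSetoid S using (Carrier; _≟_)
  count : ∀ n (f : Fin n → Carrier) → sumℤ (map (λ h → 𝟙 (does (all? (λ i → h i ≟ f i)))) (allFns n (elements E))) ≡ + 1
  count ℕ.zero f = refl
  count (ℕ.suc n) f = begin
    sumℤ (map (λ h → 𝟙 (does (all? (λ i → h i ≟ f i)))) (allFns (ℕ.suc n) (elements E)))
      ≡⟨ trans (sumℤ-concatMap-map (λ h → 𝟙 (does (all? (λ i → h i ≟ f i)))) _ fns (elements E))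
               (sumℤ-cong (λ a → sumℤ-cong (λ g → 𝟙-∧ (does (a ≟ f zero)) (matches-tail g)) fns) (elements E)) ⟩
    Σ (λ a → sumℤ (map (λ g → 𝟙 (does (a ≟ f zero)) ℤ.* 𝟙 (matches-tail g)) fns))
      ≡⟨ sumℤ-cong (λ a → sumℤ-*ˡ (𝟙 (does (a ≟ f zero))) (𝟙 ∘ matches-tail) fns) (elements E) ⟩
    Σ (λ a → 𝟙 (does (a ≟ f zero)) ℤ.* sumℤ (map (𝟙 ∘ matches-tail) fns))
      ≡⟨ sumℤ-cong (λ a → trans (cong (ℤ._*_ (𝟙 (does (a ≟ f zero)))) (count n (f ∘ suc))) (ℤP.*-identityʳ _)) (elements E) ⟩
    Σ (λ a → 𝟙 (does (a ≟ f zero)))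
      ≡⟨ count-≈ E (f zero) ⟩
    + 1 ∎
    where
    open ≡-Reasoning
    Σ : (Carrier → ℤ) → ℤ
    Σ F = sumℤ (map F (elements E))
    fns : List (Fin n → Carrier)
    fns = allFns n (elements E)
    matches-tail : (Fin n → Carrier) → Bool
    matches-tail g = does (all? (λ i → g i ≟ f (suc i)))

functionEnumeration : ∀ k n → Enumeration (Pointwise.decSetoid (≡-decSetoid k) n)
functionEnumeration k n = fnEnumeration n (finEnumeration k)

squareEnumeration : ∀ k → Enumeration (Pointwise.decSetoid (Pointwise.decSetoid (≡-decSetoid k) k) k)
squareEnumeration k = fnEnumeration k (functionEnumeration k k)

module _ {S : DecSetoid 0ℓ 0ℓ} (E : Enumeration S) where
  open DecSetoid S using (Carrier; _≈_; _≟_) renaming (refl to ≈-refl)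

  sum-allFns-constant : {W : (Fin (ℕ.suc n) → Carrier) → ℤ} → Congruent (λ σ τ → ∀ i → σ i ≈ τ i) _≡_ W →
    sumℤ (map (λ σ → 𝟙 (does (all? (λ i → σ (suc i) ≟ σ zero))) ℤ.* W σ) (allFns (ℕ.suc n) (elements E)))
      ≡ sumℤ (map (λ a → W (λ _ → a)) (elements E))
  sum-allFns-constant {n} {W} W-cong =
    trans (sumℤ-concatMap-map _ _ (allFns n (elements E)) (elements E))
          (sumℤ-cong (λ a → trans (sum-𝟙-≈-* (fnEnumeration n E) (λ τ≈τ′ → W-cong λ { zero → ≈-refl ; (suc i) → τ≈τ′ i }) (λ _ → a))
                                  (W-cong λ { zero → ≈-refl ; (suc i) → ≈-refl }))
                     (elements E))

-- The unit tensor

sgnRow-cong : ∀ {M m} k (r : Fin M → Fin m) {σ τ : Fin M → Fin k} → (∀ j → σ j ≡ τ j) → sgnRow k r σ ≡ sgnRow k r τ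
sgnRow-cong {m = m} k r σ≗τ = prodℤ-cong (λ b → cong (sgnSeq k) (List.map-cong σ≗τ (positions r b))) (allFin m)

prodℤ-unitTensor : ∀ {d M} k (σ : Fin (ℕ.suc d) → Fin M → Fin k) →
  prodℤ (map (λ j → unitTensor (ℕ.suc d) k (λ i → σ i j)) (allFin M))
    ≡ 𝟙 (does (all? (λ i → all? (λ j → σ (suc i) j Fin.≟ σ zero j))))
prodℤ-unitTensor {d} {M} k σ = begin
  prodℤ (map (λ j → 𝟙 (allB (λ i → ⌊ σ i j Fin.≟ σ zero j ⌋) (allFin (ℕ.suc d)))) (allFin M))
    ≡⟨ prodℤ-cong (λ j → cong 𝟙 (allB-isYes (λ i → σ i j Fin.≟ σ zero j))) (allFin M) ⟩
  prodℤ (map (λ j → 𝟙 (does (all? (λ i → σ i j Fin.≟ σ zero j)))) (allFin M))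
    ≡⟨ prodℤ-𝟙 (λ j → does (all? (λ i → σ i j Fin.≟ σ zero j))) (allFin M) ⟩
  𝟙 (allB (λ j → does (all? (λ i → σ i j Fin.≟ σ zero j))) (allFin M))
    ≡⟨ cong 𝟙 (allB-does-all? (λ j → all? (λ i → σ i j Fin.≟ σ zero j))) ⟩
  𝟙 (does (all? (λ j → all? (λ i → σ i j Fin.≟ σ zero j))))
    ≡⟨ cong 𝟙 (does-⇔ (mk⇔ (λ p i j → p j (suc i)) (λ p j → ∀-cons {P = λ i → σ i j ≡ σ zero j} refl (λ i → p i j)))
                        (all? (λ j → all? (λ i → σ i j Fin.≟ σ zero j))) (all? (λ i → all? (λ j → σ (suc i) j Fin.≟ σ zero j)))) ⟩
  𝟙 (does (all? (λ i → all? (λ j → σ (suc i) j Fin.≟ σ zero j)))) ∎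
  where open ≡-Reasoning

Δ-unitTensor : ∀ {d M m} k (T : Table (ℕ.suc d) M m) →
  Δ k T (unitTensor (ℕ.suc d) k) ≡ sumℤ (map (λ a → prodℤ (map (λ i → sgnRow k (T i) a) (allFin (ℕ.suc d)))) (allFns M (allFin k)))
Δ-unitTensor {d} {M} k T =
  trans (sumℤ-cong diagonal-indicator (allFns (ℕ.suc d) (allFns M (allFin k))))
        (sum-allFns-constant (fnEnumeration M (finEnumeration k)) W-cong)
  where
  W : (Fin (ℕ.suc d) → Fin M → Fin k) → ℤ
  W σ = prodℤ (map (λ i → sgnRow k (T i) (σ i)) (allFin (ℕ.suc d)))
  W-cong : ∀ {σ τ} → (∀ i j → σ i j ≡ τ i j) → W σ ≡ W τ
  W-cong σ≋τ = prodℤ-cong (λ i → sgnRow-cong k (T i) (σ≋τ i)) (allFin (ℕ.suc d))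
  diagonal-indicator : ∀ σ → W σ ℤ.* prodℤ (map (λ j → unitTensor (ℕ.suc d) k (λ i → σ i j)) (allFin M))
                             ≡ 𝟙 (does (all? (λ i → all? (λ j → σ (suc i) j Fin.≟ σ zero j)))) ℤ.* W σ
  diagonal-indicator σ = trans (cong (ℤ._*_ (W σ)) (prodℤ-unitTensor k σ)) (ℤP.*-comm (W σ) _)

data IsSign : ℤ → Set where
  sign-0 : IsSign (+ 0)
  sign-+ : IsSign (+ 1)
  sign-− : IsSign (- + 1)

IsSign-* : ∀ {x y} → IsSign x → IsSign y → IsSign (x ℤ.* y)
IsSign-* sign-0 _      = sign-0
IsSign-* sign-+ sign-0 = sign-0
IsSign-* sign-+ sign-+ = sign-+
IsSign-* sign-+ sign-− = sign-−
IsSign-* sign-− sign-0 = sign-0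
IsSign-* sign-− sign-+ = sign-−
IsSign-* sign-− sign-− = sign-+

IsSign-neg : ∀ {x} → IsSign x → IsSign (- x)
IsSign-neg sign-0 = sign-0
IsSign-neg sign-+ = sign-−
IsSign-neg sign-− = sign-+

IsSign-prodℤ : (f : A → ℤ) → (∀ x → IsSign (f x)) → (xs : List A) → IsSign (prodℤ (map f xs))
IsSign-prodℤ f f-sign [] = sign-+
IsSign-prodℤ f f-sign (x ∷ xs) = IsSign-* (f-sign x) (IsSign-prodℤ f f-sign xs)

IsSign-negOnePow : ∀ e → IsSign (negOnePow e)
IsSign-negOnePow ℕ.zero = sign-+
IsSign-negOnePow (ℕ.suc e) = IsSign-neg (IsSign-negOnePow e)

IsSign-sgnSeq : ∀ k xs → IsSign (sgnSeq k xs)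
IsSign-sgnSeq k xs with ⌊ List.length xs ℕ.≟ k ⌋ ∧ distinctB xs
... | true  = IsSign-negOnePow (inversions xs)
... | false = sign-0

IsSign-sgnRow : ∀ {M m} k (r : Fin M → Fin m) σ → IsSign (sgnRow k r σ)
IsSign-sgnRow {m = m} k r σ = IsSign-prodℤ _ (λ b → IsSign-sgnSeq k (map σ (positions r b))) (allFin m)

IsSign-^-even : ∀ {x} → IsSign x → ∀ q → x ^ (ℕ.suc q ℕ.* 2) ≡ x ℤ.* x
IsSign-^-even sign-0 q = refl
IsSign-^-even sign-+ q = ℤP.^-zeroˡ (ℕ.suc q ℕ.* 2)
IsSign-^-even sign-− ℕ.zero = refl
IsSign-^-even sign-− (ℕ.suc q) = cong (λ t → - + 1 ℤ.* (- + 1 ℤ.* t)) (IsSign-^-even sign-− q)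

negOnePow-+ : ∀ a b → negOnePow (a ℕ.+ b) ≡ negOnePow a ℤ.* negOnePow b
negOnePow-+ ℕ.zero b = sym (ℤP.*-identityˡ (negOnePow b))
negOnePow-+ (ℕ.suc a) b = trans (cong -_ (negOnePow-+ a b)) (ℤP.neg-distribˡ-* (negOnePow a) (negOnePow b))

negOnePow-square : ∀ a → negOnePow a ℤ.* negOnePow a ≡ + 1
negOnePow-square ℕ.zero = refl
negOnePow-square (ℕ.suc a) = begin
  - x ℤ.* - x     ≡⟨ ℤP.neg-distribˡ-* x (- x) ⟨
  - (x ℤ.* - x)   ≡⟨ cong -_ (ℤP.neg-distribʳ-* x x) ⟨
  - - (x ℤ.* x)   ≡⟨ ℤP.neg-involutive (x ℤ.* x) ⟩
  x ℤ.* x         ≡⟨ negOnePow-square a ⟩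
  + 1             ∎
  where
  open ≡-Reasoning
  x = negOnePow a

negOnePow-double : ∀ a → negOnePow (2 ℕ.* a) ≡ + 1
negOnePow-double a = trans (cong (λ b → negOnePow (a ℕ.+ b)) (ℕP.+-identityʳ a)) (trans (negOnePow-+ a a) (negOnePow-square a))

negOnePow≢0 : ∀ e → negOnePow e ≢ + 0
negOnePow≢0 (ℕ.suc e) eq = negOnePow≢0 e (trans (sym (ℤP.neg-involutive _)) (cong -_ eq))

-- The rows of the table T

allFin-+ : ∀ m n → allFin (m ℕ.+ n) ≡ map (Fin._↑ˡ n) (allFin m) ++ map (m Fin.↑ʳ_) (allFin n)
allFin-+ ℕ.zero n = sym (List.map-id (allFin n))
allFin-+ (ℕ.suc m) n = begin
  allFin (ℕ.suc m ℕ.+ n)                                         ≡⟨ allFin-suc ⟩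
  zero ∷ map suc (allFin (m ℕ.+ n))                              ≡⟨ cong (λ xs → zero ∷ map suc xs) (allFin-+ m n) ⟩
  zero ∷ map suc (map (Fin._↑ˡ n) (allFin m) ++ map (m Fin.↑ʳ_) (allFin n))
    ≡⟨ cong (zero ∷_) (List.map-++ suc (map (Fin._↑ˡ n) (allFin m)) _) ⟩
  zero ∷ map suc (map (Fin._↑ˡ n) (allFin m)) ++ map suc (map (m Fin.↑ʳ_) (allFin n))
    ≡⟨ cong₂ (λ xs ys → zero ∷ xs ++ ys) (sym (List.map-∘ (allFin m))) (sym (List.map-∘ (allFin n))) ⟩
  zero ∷ map (λ i → suc i Fin.↑ˡ n) (allFin m) ++ map (ℕ.suc m Fin.↑ʳ_) (allFin n)
    ≡⟨ cong (λ xs → zero ∷ xs ++ map (ℕ.suc m Fin.↑ʳ_) (allFin n)) (List.map-∘ (allFin m)) ⟩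
  zero ∷ map (Fin._↑ˡ n) (map suc (allFin m)) ++ map (ℕ.suc m Fin.↑ʳ_) (allFin n)
    ≡⟨ cong (λ xs → map (Fin._↑ˡ n) xs ++ map (ℕ.suc m Fin.↑ʳ_) (allFin n)) allFin-suc ⟨
  map (Fin._↑ˡ n) (allFin (ℕ.suc m)) ++ map (ℕ.suc m Fin.↑ʳ_) (allFin n) ∎
  where open ≡-Reasoning

allFin-* : ∀ m n → allFin (m ℕ.* n) ≡ concatMap (λ i → map (Fin.combine i) (allFin n)) (allFin m)
allFin-* ℕ.zero n = refl
allFin-* (ℕ.suc m) n = begin
  allFin (n ℕ.+ m ℕ.* n)
    ≡⟨ allFin-+ n (m ℕ.* n) ⟩
  map (Fin.combine {ℕ.suc m} zero) (allFin n) ++ map (n Fin.↑ʳ_) (allFin (m ℕ.* n))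
    ≡⟨ cong (λ xs → map (Fin.combine {ℕ.suc m} zero) (allFin n) ++ map (n Fin.↑ʳ_) xs) (allFin-* m n) ⟩
  map (Fin.combine {ℕ.suc m} zero) (allFin n) ++ map (n Fin.↑ʳ_) (concatMap (λ i → map (Fin.combine i) (allFin n)) (allFin m))
    ≡⟨ cong (map (Fin.combine {ℕ.suc m} zero) (allFin n) ++_) (List.map-concatMap (n Fin.↑ʳ_) _ (allFin m)) ⟩
  map (Fin.combine {ℕ.suc m} zero) (allFin n) ++ concatMap (λ i → map (n Fin.↑ʳ_) (map (Fin.combine i) (allFin n))) (allFin m)
    ≡⟨ cong (map (Fin.combine {ℕ.suc m} zero) (allFin n) ++_) (List.concatMap-cong (λ i → sym (List.map-∘ (allFin n))) (allFin m)) ⟩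
  map (Fin.combine {ℕ.suc m} zero) (allFin n) ++ concatMap (λ i → map (Fin.combine {ℕ.suc m} (suc i)) (allFin n)) (allFin m)
    ≡⟨ cong (map (Fin.combine {ℕ.suc m} zero) (allFin n) ++_) (List.concatMap-map (λ i → map (Fin.combine {ℕ.suc m} i) (allFin n)) suc (allFin m)) ⟨
  concatMap (λ i → map (Fin.combine {ℕ.suc m} i) (allFin n)) (zero ∷ map suc (allFin m))
    ≡⟨ cong (concatMap (λ i → map (Fin.combine {ℕ.suc m} i) (allFin n))) allFin-suc ⟨
  concatMap (λ i → map (Fin.combine {ℕ.suc m} i) (allFin n)) (allFin (ℕ.suc m)) ∎
  where open ≡-Reasoning

module _ {P : Pred B 0ℓ} (P? : Decidable P) where

  filter-concatMap : (g : A → List B) (xs : List A) → filter P? (concatMap g xs) ≡ concatMap (filter P? ∘ g) xs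
  filter-concatMap g [] = refl
  filter-concatMap g (x ∷ xs) =
    trans (List.filter-++ P? (g x) (concatMap g xs)) (cong (filter P? (g x) ++_) (filter-concatMap g xs))

  filter-map : (f : A → B) (xs : List A) → filter P? (map f xs) ≡ map f (filter (P? ∘ f) xs)
  filter-map f [] = refl
  filter-map f (x ∷ xs) with does (P? (f x))
  ... | true  = cong (f x ∷_) (filter-map f xs)
  ... | false = filter-map f xs

filter-≟-allFin : (b : Fin n) → filter (Fin._≟ b) (allFin n) ≡ b ∷ []
filter-≟-allFin {ℕ.suc n} b = begin
  filter (Fin._≟ b) (allFin (ℕ.suc n))              ≡⟨ cong (filter (Fin._≟ b)) allFin-suc ⟩
  filter (Fin._≟ b) (zero ∷ map suc (allFin n))    ≡⟨ head-and-tail b ⟩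
  b ∷ [] ∎
  where
  open ≡-Reasoning
  head-and-tail : (b : Fin (ℕ.suc n)) → filter (Fin._≟ b) (zero ∷ map suc (allFin n)) ≡ b ∷ []
  head-and-tail zero = cong (zero ∷_) (trans (filter-map (Fin._≟ zero) suc (allFin n))
                                             (cong (map suc) (List.filter-none _ (All.universal (λ _ ()) (allFin n)))))
  head-and-tail (suc b) = trans (filter-map (Fin._≟ suc b) suc (allFin n)) $ begin
    map suc (filter (λ i → suc i Fin.≟ suc b) (allFin n)) ≡⟨ cong (map suc) (List.filter-≐ _ (Fin._≟ b) (Fin.suc-injective , cong suc) (allFin n)) ⟩
    map suc (filter (Fin._≟ b) (allFin n))                ≡⟨ cong (map suc) (filter-≟-allFin b) ⟩
    suc b ∷ [] ∎

concatMap-allFin-single : ∀ {m} (g : Fin m → List B) (b : Fin m) → (∀ i → i ≢ b → g i ≡ []) → concatMap g (allFin m) ≡ g b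
concatMap-allFin-single {m = ℕ.suc m} g b g≡[] = begin
  concatMap g (allFin (ℕ.suc m))                  ≡⟨ cong (concatMap g) allFin-suc ⟩
  g zero ++ concatMap g (map suc (allFin m))      ≡⟨ cong (g zero ++_) (List.concatMap-map g suc (allFin m)) ⟩
  g zero ++ concatMap (g ∘ suc) (allFin m)        ≡⟨ split b g≡[] ⟩
  g b                                             ∎
  where
  open ≡-Reasoning
  all-[] : ∀ {m} (h : Fin m → List B) → (∀ i → h i ≡ []) → concatMap h (allFin m) ≡ []
  all-[] {m = ℕ.zero} h h≡[] = refl
  all-[] {m = ℕ.suc m} h h≡[] = begin
    concatMap h (allFin (ℕ.suc m))                ≡⟨ cong (concatMap h) allFin-suc ⟩
    h zero ++ concatMap h (map suc (allFin m))    ≡⟨ cong₂ _++_ (h≡[] zero) (List.concatMap-map h suc (allFin m)) ⟩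
    concatMap (h ∘ suc) (allFin m)                ≡⟨ all-[] (h ∘ suc) (h≡[] ∘ suc) ⟩
    []                                            ∎
  split : (b : Fin (ℕ.suc m)) → (∀ i → i ≢ b → g i ≡ []) → g zero ++ concatMap (g ∘ suc) (allFin m) ≡ g b
  split zero g≡[] =
    trans (cong (g zero ++_) (all-[] (g ∘ suc) (λ i → g≡[] (suc i) λ ()))) (List.++-identityʳ (g zero))
  split (suc b) g≡[] =
    trans (cong (_++ concatMap (g ∘ suc) (allFin m)) (g≡[] zero λ ()))
          (concatMap-allFin-single (g ∘ suc) b (λ i i≢b → g≡[] (suc i) (i≢b ∘ Fin.suc-injective)))

quotient-combine : ∀ {m n} (i : Fin m) (j : Fin n) → Fin.quotient n (Fin.combine i j) ≡ i
quotient-combine i j = cong proj₁ (Fin.remQuot-combine i j)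

remainder-combine : ∀ {m n} (i : Fin m) (j : Fin n) → Fin.remainder {m} n (Fin.combine i j) ≡ j
remainder-combine i j = cong proj₂ (Fin.remQuot-combine i j)

positions-quotient : ∀ {m} n (b : Fin m) → positions (Fin.quotient {m} n) b ≡ map (Fin.combine b) (allFin n)
positions-quotient {m} n b = begin
  filter P? (allFin (m ℕ.* n))
    ≡⟨ cong (filter P?) (allFin-* m n) ⟩
  filter P? (concatMap (λ i → map (Fin.combine i) (allFin n)) (allFin m))
    ≡⟨ filter-concatMap P? (λ i → map (Fin.combine i) (allFin n)) (allFin m) ⟩
  concatMap (λ i → filter P? (map (Fin.combine i) (allFin n))) (allFin m)
    ≡⟨ concatMap-allFin-single _ b (λ i i≢b → trans (filter-map P? (Fin.combine i) (allFin n))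
                                        (cong (map (Fin.combine i)) (List.filter-none _ (All.universal (λ c → i≢b ∘ trans (sym (quotient-combine i c))) (allFin n))))) ⟩
  filter P? (map (Fin.combine b) (allFin n))
    ≡⟨ filter-map P? (Fin.combine b) (allFin n) ⟩
  map (Fin.combine b) (filter (P? ∘ Fin.combine b) (allFin n))
    ≡⟨ cong (map (Fin.combine b)) (List.filter-all _ (All.universal (quotient-combine b) (allFin n))) ⟩
  map (Fin.combine b) (allFin n) ∎
  where
  open ≡-Reasoning
  P? : (j : Fin (m ℕ.* n)) → Dec (Fin.quotient {m} n j ≡ b)
  P? j = Fin.quotient {m} n j Fin.≟ b

positions-remainder : ∀ {m} n (c : Fin n) → positions (Fin.remainder {m} n) c ≡ map (λ i → Fin.combine i c) (allFin m)
positions-remainder {m} n c = begin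
  filter P? (allFin (m ℕ.* n))
    ≡⟨ cong (filter P?) (allFin-* m n) ⟩
  filter P? (concatMap (λ i → map (Fin.combine i) (allFin n)) (allFin m))
    ≡⟨ filter-concatMap P? (λ i → map (Fin.combine i) (allFin n)) (allFin m) ⟩
  concatMap (λ i → filter P? (map (Fin.combine i) (allFin n))) (allFin m)
    ≡⟨ List.concatMap-cong (λ i → trans (filter-map P? (Fin.combine i) (allFin n)) (cong (map (Fin.combine i)) (only-c i))) (allFin m) ⟩
  concatMap (List.[_] ∘ (λ i → Fin.combine i c)) (allFin m)
    ≡⟨ List.concatMap-map List.[_] (λ i → Fin.combine i c) (allFin m) ⟨
  concatMap List.[_] (map (λ i → Fin.combine i c) (allFin m))
    ≡⟨ List.concatMap-pure (map (λ i → Fin.combine i c) (allFin m)) ⟩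
  map (λ i → Fin.combine i c) (allFin m) ∎
  where
  open ≡-Reasoning
  P? : (j : Fin (m ℕ.* n)) → Dec (Fin.remainder {m} n j ≡ c)
  P? j = Fin.remainder {m} n j Fin.≟ c
  only-c : ∀ i → filter (P? ∘ Fin.combine i) (allFin n) ≡ c ∷ []
  only-c i = trans (List.filter-≐ (P? ∘ Fin.combine i) (Fin._≟ c)
                      ((λ {d} → trans (sym (remainder-combine i d))) , (λ {d} → trans (remainder-combine i d))) (allFin n))
                   (filter-≟-allFin c)

isYes-suc-≟ : ∀ a b → ⌊ ℕ.suc a ℕ.≟ ℕ.suc b ⌋ ≡ ⌊ a ℕ.≟ b ⌋
isYes-suc-≟ a b = trans (isYes≗does (ℕ.suc a ℕ.≟ ℕ.suc b)) (sym (isYes≗does (a ℕ.≟ b)))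

prodℤ-lastRow : ∀ n (R C : ℤ) →
  prodℤ (map (λ i → if ⌊ ℕ.suc (Fin.toℕ i) ℕ.≟ ℕ.suc n ⌋ then C else R) (allFin (ℕ.suc n))) ≡ R ^ n ℤ.* C
prodℤ-lastRow ℕ.zero R C = trans (ℤP.*-identityʳ C) (sym (ℤP.*-identityˡ C))
prodℤ-lastRow (ℕ.suc n) R C = begin
  prodℤ (map (row (ℕ.suc n)) (allFin (ℕ.suc (ℕ.suc n))))
    ≡⟨ cong prodℤ (map-allFin-suc (row (ℕ.suc n))) ⟩
  R ℤ.* prodℤ (map (row (ℕ.suc n) ∘ suc) (allFin (ℕ.suc n)))
    ≡⟨ cong (R ℤ.*_) (prodℤ-cong (λ i → cong (λ b → if b then C else R) (isYes-suc-≟ (ℕ.suc (Fin.toℕ i)) (ℕ.suc n))) (allFin (ℕ.suc n))) ⟩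
  R ℤ.* prodℤ (map (row n) (allFin (ℕ.suc n)))
    ≡⟨ cong (R ℤ.*_) (prodℤ-lastRow n R C) ⟩
  R ℤ.* (R ^ n ℤ.* C)
    ≡⟨ ℤP.*-assoc R (R ^ n) C ⟨
  R ^ ℕ.suc n ℤ.* C ∎
  where
  open ≡-Reasoning
  row : ∀ m → Fin (ℕ.suc m) → ℤ
  row m i = if ⌊ ℕ.suc (Fin.toℕ i) ℕ.≟ ℕ.suc m ⌋ then C else R

sgnRow-tableT : ∀ d k (i : Fin d) a → sgnRow k (tableT d k i) a
  ≡ (if ⌊ ℕ.suc (Fin.toℕ i) ℕ.≟ d ⌋ then sgnRow k (Fin.remainder {k} k) a else sgnRow k (Fin.quotient {k} k) a)
sgnRow-tableT d k i a with ⌊ ℕ.suc (Fin.toℕ i) ℕ.≟ d ⌋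
... | true  = refl
... | false = refl

Square : ℕ → Set
Square k = Fin k → Fin k → Fin k

rowsSign colsSign : ∀ k → Square k → ℤ
rowsSign k L = prodℤ (map (λ i → sgnSeq k (map (λ j → L i j) (allFin k))) (allFin k))
colsSign k L = prodℤ (map (λ j → sgnSeq k (map (λ i → L i j) (allFin k))) (allFin k))

rowsSign-cong : ∀ k {L L′ : Square k} → (∀ i j → L i j ≡ L′ i j) → rowsSign k L ≡ rowsSign k L′
rowsSign-cong k L≋L′ = prodℤ-cong (λ i → cong (sgnSeq k) (List.map-cong (L≋L′ i) (allFin k))) (allFin k)

colsSign-cong : ∀ k {L L′ : Square k} → (∀ i j → L i j ≡ L′ i j) → colsSign k L ≡ colsSign k L′
colsSign-cong k L≋L′ = prodℤ-cong (λ j → cong (sgnSeq k) (List.map-cong (λ i → L≋L′ i j) (allFin k))) (allFin k)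

-- Position j of a row of T is the cell (quotient j, remainder j) of a k × k square: the first
-- d − 1 rows of T group the positions by rows of the square, the last row by columns.
unflatten : ∀ {k} → (Fin (k ℕ.* k) → Fin k) → Square k
unflatten a i j = a (Fin.combine i j)

sgnRow-quotient : ∀ k a → sgnRow k (Fin.quotient {k} k) a ≡ rowsSign k (unflatten a)
sgnRow-quotient k a = prodℤ-cong
  (λ b → cong (sgnSeq k) (trans (cong (map a) (positions-quotient k b)) (sym (List.map-∘ (allFin k))))) (allFin k)

sgnRow-remainder : ∀ k a → sgnRow k (Fin.remainder {k} k) a ≡ colsSign k (unflatten a)
sgnRow-remainder k a = prodℤ-cong
  (λ c → cong (sgnSeq k) (trans (cong (map a) (positions-remainder k c)) (sym (List.map-∘ (allFin k))))) (allFin k)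

unflatten-inverse : ∀ k → Inverse (DecSetoid.setoid (Pointwise.decSetoid (≡-decSetoid k) (k ℕ.* k)))
                                  (DecSetoid.setoid (Pointwise.decSetoid (Pointwise.decSetoid (≡-decSetoid k) k) k))
unflatten-inverse k = strictInverse unflatten flatten
  (λ a≋b i j → a≋b (Fin.combine i j))
  (λ L≋L′ j → L≋L′ (Fin.quotient k j) (Fin.remainder {k} k j))
  (λ L i j → cong₂ L (quotient-combine i j) (remainder-combine i j))
  (λ a j → cong a (Fin.combine-remQuot {k} k j))
  where
  flatten : Square k → Fin (k ℕ.* k) → Fin k
  flatten L j = L (Fin.quotient k j) (Fin.remainder {k} k j)

Δ-tableT : ∀ q k → let d = ℕ.suc (ℕ.suc q ℕ.* 2) in
  Δ k (tableT d k) (unitTensor d k)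
    ≡ sumℤ (map (λ L → rowsSign k L ℤ.* rowsSign k L ℤ.* colsSign k L) (elements (squareEnumeration k)))
Δ-tableT q k = begin
  Δ k (tableT d k) (unitTensor d k)
    ≡⟨ Δ-unitTensor k (tableT d k) ⟩
  sumℤ (map (λ a → prodℤ (map (λ i → sgnRow k (tableT d k i) a) (allFin d))) (allFns (k ℕ.* k) (allFin k)))
    ≡⟨ sumℤ-cong rows (allFns (k ℕ.* k) (allFin k)) ⟩
  sumℤ (map (G ∘ unflatten) (allFns (k ℕ.* k) (allFin k)))
    ≡⟨ sum-reindex (functionEnumeration k (k ℕ.* k)) (squareEnumeration k) (unflatten-inverse k) G-cong ⟩
  sumℤ (map G (elements (squareEnumeration k))) ∎
  where
  open ≡-Reasoning
  d = ℕ.suc (ℕ.suc q ℕ.* 2)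
  G : Square k → ℤ
  G L = rowsSign k L ℤ.* rowsSign k L ℤ.* colsSign k L
  G-cong : ∀ {L L′} → (∀ i j → L i j ≡ L′ i j) → G L ≡ G L′
  G-cong L≋L′ = cong₂ (λ r c → r ℤ.* r ℤ.* c) (rowsSign-cong k L≋L′) (colsSign-cong k L≋L′)
  R C : (Fin (k ℕ.* k) → Fin k) → ℤ
  R = sgnRow k (Fin.quotient {k} k)
  C = sgnRow k (Fin.remainder {k} k)
  rows : ∀ a → prodℤ (map (λ i → sgnRow k (tableT d k i) a) (allFin d)) ≡ G (unflatten a)
  rows a = begin
    prodℤ (map (λ i → sgnRow k (tableT d k i) a) (allFin d))
      ≡⟨ prodℤ-cong (λ i → sgnRow-tableT d k i a) (allFin d) ⟩
    prodℤ (map (λ i → if ⌊ ℕ.suc (Fin.toℕ i) ℕ.≟ d ⌋ then C a else R a) (allFin d))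
      ≡⟨ prodℤ-lastRow (ℕ.suc q ℕ.* 2) (R a) (C a) ⟩
    R a ^ (ℕ.suc q ℕ.* 2) ℤ.* C a
      ≡⟨ cong (ℤ._* C a) (IsSign-^-even (IsSign-sgnRow k (Fin.quotient {k} k) a) q) ⟩
    R a ℤ.* R a ℤ.* C a
      ≡⟨ cong₂ (λ r c → r ℤ.* r ℤ.* c) (sgnRow-quotient k a) (sgnRow-remainder k a) ⟩
    G (unflatten a) ∎

-- Permutations of Fin n and their inverses

distinctB-allFin-suc : (f : Fin (ℕ.suc n) → Fin k) → distinctB (map f (allFin (ℕ.suc n)))
  ≡ allB (λ i → not ⌊ f zero Fin.≟ f (suc i) ⌋) (allFin n) ∧ distinctB (map (f ∘ suc) (allFin n))
distinctB-allFin-suc {n} f = trans (cong distinctB (map-allFin-suc f))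
  (cong (_∧ distinctB (map (f ∘ suc) (allFin n))) (allB-map (λ y → not ⌊ f zero Fin.≟ y ⌋) (f ∘ suc) (allFin n)))

distinctB⇒injective : (f : Fin n → Fin k) → distinctB (map f (allFin n)) ≡ true → Injective _≡_ _≡_ f
distinctB⇒injective {ℕ.suc n} f distinct {x} {y}
  with ∧-true⁻ {allB (λ i → not ⌊ f zero Fin.≟ f (suc i) ⌋) (allFin n)} (trans (sym (distinctB-allFin-suc f)) distinct)
... | head-fresh , tail-distinct = go x y
  where
  f0∉tail : ∀ i → f zero ≢ f (suc i)
  f0∉tail i = not-isYes⇒¬ (f zero Fin.≟ f (suc i)) (allB-allFin⁻ _ head-fresh i)
  go : ∀ x y → f x ≡ f y → x ≡ y
  go zero    zero    _   = refl
  go zero    (suc j) fx≡fy = ⊥-elim (f0∉tail j fx≡fy)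
  go (suc i) zero    fx≡fy = ⊥-elim (f0∉tail i (sym fx≡fy))
  go (suc i) (suc j) fx≡fy = cong suc (distinctB⇒injective (f ∘ suc) tail-distinct fx≡fy)

injective⇒distinctB : (f : Fin n → Fin k) → Injective _≡_ _≡_ f → distinctB (map f (allFin n)) ≡ true
injective⇒distinctB {ℕ.zero} f f-inj = refl
injective⇒distinctB {ℕ.suc n} f f-inj = trans (distinctB-allFin-suc f)
  (cong₂ _∧_ (allB-allFin⁺ _ (λ i → ¬⇒not-isYes (f zero Fin.≟ f (suc i)) (λ eq → 0≢suc (f-inj eq))))
             (injective⇒distinctB (f ∘ suc) (Fin.suc-injective ∘ f-inj)))
  where
  0≢suc : ∀ {i : Fin n} → zero ≢ suc i
  0≢suc ()

injective⇒surjective : {ρ : Fin n → Fin n} → Injective _≡_ _≡_ ρ → ∀ s → ∃ λ c → ρ c ≡ s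
injective⇒surjective {ℕ.suc n} {ρ} ρ-inj s with any? (λ c → ρ c Fin.≟ s)
... | yes hit = hit
... | no ¬hit = ⊥-elim (ℕP.<-irrefl refl (injective⇒≤ squeeze-injective))
  where
  s∉image : ∀ c → s ≢ ρ c
  s∉image c s≡ρc = ¬hit (c , sym s≡ρc)
  squeeze : Fin (ℕ.suc n) → Fin n
  squeeze c = punchOut (s∉image c)
  squeeze-injective : Injective _≡_ _≡_ squeeze
  squeeze-injective {c} {c′} eq = ρ-inj (punchOut-injective (s∉image c) (s∉image c′) eq)

-- A value without preimage is sent to itself.
preimage : (Fin n → Fin n) → Fin n → Fin n
preimage ρ s with any? (λ c → ρ c Fin.≟ s)
... | yes (c , _) = c
... | no _        = s

module _ {ρ : Fin n → Fin n} (ρ-inj : Injective _≡_ _≡_ ρ) where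

  preimage-inverseˡ : ∀ s → ρ (preimage ρ s) ≡ s
  preimage-inverseˡ s with any? (λ c → ρ c Fin.≟ s)
  ... | yes (c , ρc≡s) = ρc≡s
  ... | no ¬hit        = ⊥-elim (¬hit (injective⇒surjective ρ-inj s))

  preimage-inverseʳ : ∀ c → preimage ρ (ρ c) ≡ c
  preimage-inverseʳ c = ρ-inj (preimage-inverseˡ (ρ c))

  preimage-injective : Injective _≡_ _≡_ (preimage ρ)
  preimage-injective {s} {s′} eq = trans (sym (preimage-inverseˡ s)) (trans (cong ρ eq) (preimage-inverseˡ s′))

  ∑-injective : (f : Fin n → ℕ) → ∑[ i < n ] f (ρ i) ≡ ∑[ i < n ] f i
  ∑-injective f = sym (∑-permute f (permutation ρ (preimage ρ) preimage-inverseˡ preimage-inverseʳ))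

preimage-cong : {ρ ρ′ : Fin n → Fin n} → Injective _≡_ _≡_ ρ → (∀ c → ρ c ≡ ρ′ c) → ∀ s → preimage ρ s ≡ preimage ρ′ s
preimage-cong {ρ = ρ} {ρ′} ρ-inj ρ≗ρ′ s =
  ρ-inj (trans (preimage-inverseˡ ρ-inj s) (sym (trans (ρ≗ρ′ _) (preimage-inverseˡ ρ′-inj s))))
  where
  ρ′-inj : Injective _≡_ _≡_ ρ′
  ρ′-inj eq = ρ-inj (trans (ρ≗ρ′ _) (trans eq (sym (ρ≗ρ′ _))))

isPermutationB : (Fin n → Fin n) → Bool
isPermutationB {n} ρ = distinctB (map ρ (allFin n))

isPermutationB-cong : {ρ ρ′ : Fin n → Fin n} → (∀ c → ρ c ≡ ρ′ c) → isPermutationB ρ ≡ isPermutationB ρ′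
isPermutationB-cong {n} ρ≗ρ′ = cong distinctB (List.map-cong ρ≗ρ′ (allFin n))

-- Rows that are not permutations are kept, which makes invertRows an involution of all squares.
invertRow : (Fin n → Fin n) → Fin n → Fin n
invertRow ρ = if isPermutationB ρ then preimage ρ else ρ

isPermutationB-preimage : (ρ : Fin n → Fin n) → isPermutationB ρ ≡ true → isPermutationB (preimage ρ) ≡ true
isPermutationB-preimage ρ perm = injective⇒distinctB (preimage ρ) (preimage-injective (distinctB⇒injective ρ perm))

isPermutationB-invertRow : (ρ : Fin n → Fin n) → isPermutationB (invertRow ρ) ≡ isPermutationB ρ
isPermutationB-invertRow ρ with isPermutationB ρ in perm
... | true  = isPermutationB-preimage ρ perm
... | false = perm

invertRow-involutive : (ρ : Fin n → Fin n) → ∀ s → invertRow (invertRow ρ) s ≡ ρ s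
invertRow-involutive ρ s with isPermutationB ρ in perm
... | false rewrite perm = refl
... | true rewrite isPermutationB-preimage ρ perm =
  preimage-injective ρ-inj (trans (preimage-inverseˡ (preimage-injective ρ-inj) s) (sym (preimage-inverseʳ ρ-inj s)))
  where
  ρ-inj = distinctB⇒injective ρ perm

invertRow-cong : {ρ ρ′ : Fin n → Fin n} → (∀ c → ρ c ≡ ρ′ c) → ∀ s → invertRow ρ s ≡ invertRow ρ′ s
invertRow-cong {ρ = ρ} {ρ′} ρ≗ρ′ s rewrite sym (isPermutationB-cong ρ≗ρ′) with isPermutationB ρ in perm
... | true  = preimage-cong (distinctB⇒injective ρ perm) ρ≗ρ′ s
... | false = ρ≗ρ′ s

invertRow-permutation : {ρ : Fin n → Fin n} → isPermutationB ρ ≡ true → ∀ s → invertRow ρ s ≡ preimage ρ s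
invertRow-permutation perm s rewrite perm = refl

-- Counting inversions

χ : Bool → ℕ
χ b = if b then 1 else 0

χ< χ≡ : Fin n → Fin n → ℕ
χ< x y = χ (does (x Fin.<? y))
χ≡ x y = χ (does (x Fin.≟ y))

inversionCount : (Fin n → Fin k) → ℕ
inversionCount {n} f = ∑[ i < n ] ∑[ j < n ] (χ< i j ℕ.* χ< (f j) (f i))

length-filter-tabulate : ∀ {P : A → Set} (P? : ∀ x → Dec (P x)) (g : Fin n → A) →
  List.length (List.filter P? (List.tabulate g)) ≡ ∑[ j < n ] χ (does (P? (g j)))
length-filter-tabulate {n = ℕ.zero} P? g = refl
length-filter-tabulate {n = ℕ.suc n} P? g with does (P? (g zero))
... | true  = cong ℕ.suc (length-filter-tabulate P? (g ∘ suc))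
... | false = length-filter-tabulate P? (g ∘ suc)

inversions-tabulate : (f : Fin n → Fin k) → inversions (List.tabulate f) ≡ inversionCount f
inversions-tabulate {ℕ.zero} f = refl
inversions-tabulate {ℕ.suc n} f =
  cong₂ ℕ._+_ (trans (length-filter-tabulate (Fin._<? f zero) (f ∘ suc))
                     (sum-cong-≗ {x = λ j → χ< (f (suc j)) (f zero)} (λ j → sym (ℕP.+-identityʳ _))))
              (inversions-tabulate (f ∘ suc))

inversions-inversionCount : (f : Fin n → Fin k) → inversions (map f (allFin n)) ≡ inversionCount f
inversions-inversionCount f = trans (cong inversions (List.map-tabulate id f)) (inversions-tabulate f)

sgnSeq-allFin : (f : Fin k → Fin k) → sgnSeq k (map f (allFin k)) ≡ (if isPermutationB f then negOnePow (inversionCount f) else + 0)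
sgnSeq-allFin {k} f = cong₂ (λ b e → if b ∧ isPermutationB f then negOnePow e else + 0) length≡k (inversions-inversionCount f)
  where
  length≡k : ⌊ List.length (map f (allFin k)) ℕ.≟ k ⌋ ≡ true
  length≡k = trans (isYes≗does (List.length (map f (allFin k)) ℕ.≟ k))
                   (dec-true (List.length (map f (allFin k)) ℕ.≟ k) (trans (List.length-map f (allFin k)) (List.length-tabulate {n = k} id)))

prodℤ-signs : (p : Fin n → Bool) (e : Fin n → ℕ) →
  prodℤ (map (λ i → if p i then negOnePow (e i) else + 0) (allFin n)) ≡ (if allB p (allFin n) then negOnePow (∑[ i < n ] e i) else + 0)
prodℤ-signs {ℕ.zero} p e = refl
prodℤ-signs {ℕ.suc n} p e = begin
  prodℤ (map (λ i → if p i then negOnePow (e i) else + 0) (allFin (ℕ.suc n)))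
    ≡⟨ cong prodℤ (map-allFin-suc (λ i → if p i then negOnePow (e i) else + 0)) ⟩
  (if p zero then negOnePow (e zero) else + 0) ℤ.* prodℤ (map (λ i → if p (suc i) then negOnePow (e (suc i)) else + 0) (allFin n))
    ≡⟨ cong (ℤ._*_ (if p zero then negOnePow (e zero) else + 0)) (prodℤ-signs (p ∘ suc) (e ∘ suc)) ⟩
  (if p zero then negOnePow (e zero) else + 0) ℤ.* (if allB (p ∘ suc) (allFin n) then negOnePow (∑[ i < n ] e (suc i)) else + 0)
    ≡⟨ combine (p zero) (allB (p ∘ suc) (allFin n)) ⟩
  (if p zero ∧ allB (p ∘ suc) (allFin n) then negOnePow (∑[ i < ℕ.suc n ] e i) else + 0)
    ≡⟨ cong (λ b → if b then negOnePow (∑[ i < ℕ.suc n ] e i) else + 0) (allB-allFin-suc p) ⟨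
  (if allB p (allFin (ℕ.suc n)) then negOnePow (∑[ i < ℕ.suc n ] e i) else + 0) ∎
  where
  open ≡-Reasoning
  combine : ∀ a b → (if a then negOnePow (e zero) else + 0) ℤ.* (if b then negOnePow (∑[ i < n ] e (suc i)) else + 0)
                    ≡ (if a ∧ b then negOnePow (∑[ i < ℕ.suc n ] e i) else + 0)
  combine true  true  = sym (negOnePow-+ (e zero) _)
  combine true  false = ℤP.*-zeroʳ (negOnePow (e zero))
  combine false _     = refl

data Order3 : ℕ → ℕ → ℕ → Set where
  less    : Order3 1 0 0
  equal   : Order3 0 0 1
  greater : Order3 0 1 0

order3 : (x y : Fin n) → Order3 (χ< x y) (χ< y x) (χ≡ x y)
order3 x y with Fin.<-cmp x y
... | tri< x<y x≢y y≮x rewrite dec-true (x Fin.<? y) x<y | dec-false (y Fin.<? x) y≮x | dec-false (x Fin.≟ y) x≢y = less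
... | tri≈ x≮y x≡y y≮x rewrite dec-false (x Fin.<? y) x≮y | dec-false (y Fin.<? x) y≮x | dec-true (x Fin.≟ y) x≡y = equal
... | tri> x≮y x≢y y<x rewrite dec-false (x Fin.<? y) x≮y | dec-true (y Fin.<? x) y<x | dec-false (x Fin.≟ y) x≢y = greater

χ-trichotomy : (x y : Fin n) → χ< x y ℕ.+ χ< y x ℕ.+ χ≡ x y ≡ 1
χ-trichotomy x y = go (order3 x y)
  where
  go : ∀ {a b e} → Order3 a b e → a ℕ.+ b ℕ.+ e ≡ 1
  go less    = refl
  go equal   = refl
  go greater = refl

χ<-decomposition : (c c′ v v′ : Fin n) →
  χ< c′ c ℕ.+ χ< v′ v ≡ χ≡ c c′ ℕ.* χ< v′ v ℕ.+ χ≡ v v′ ℕ.* χ< c′ c ℕ.+ χ< c c′ ℕ.* χ< v′ v ℕ.+ χ< c′ c ℕ.* χ< v v′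
                          ℕ.+ 2 ℕ.* (χ< c′ c ℕ.* χ< v′ v)
χ<-decomposition c c′ v v′ = go (order3 c c′) (order3 v v′)
  where
  go : ∀ {a₁ a₂ a₃ b₁ b₂ b₃} → Order3 a₁ a₂ a₃ → Order3 b₁ b₂ b₃ →
    a₂ ℕ.+ b₂ ≡ a₃ ℕ.* b₂ ℕ.+ b₃ ℕ.* a₂ ℕ.+ a₁ ℕ.* b₂ ℕ.+ a₂ ℕ.* b₁ ℕ.+ 2 ℕ.* (a₂ ℕ.* b₂)
  go less    less    = refl
  go less    equal   = refl
  go less    greater = refl
  go equal   less    = refl
  go equal   equal   = refl
  go equal   greater = refl
  go greater less    = refl
  go greater equal   = refl
  go greater greater = refl

*-distribˡ-identity : ∀ p x y a b c d e → x ℕ.+ y ≡ a ℕ.+ b ℕ.+ c ℕ.+ d ℕ.+ 2 ℕ.* e →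
  p ℕ.* x ℕ.+ p ℕ.* y ≡ p ℕ.* a ℕ.+ p ℕ.* b ℕ.+ p ℕ.* c ℕ.+ p ℕ.* d ℕ.+ 2 ℕ.* (p ℕ.* e)
*-distribˡ-identity p x y a b c d e eq = begin
  p ℕ.* x ℕ.+ p ℕ.* y                          ≡⟨ ℕP.*-distribˡ-+ p x y ⟨
  p ℕ.* (x ℕ.+ y)                              ≡⟨ cong (p ℕ.*_) eq ⟩
  p ℕ.* (a ℕ.+ b ℕ.+ c ℕ.+ d ℕ.+ 2 ℕ.* e)      ≡⟨ solve 6 (λ p a b c d e → p :* (a :+ b :+ c :+ d :+ con 2 :* e)
                                                     := p :* a :+ p :* b :+ p :* c :+ p :* d :+ con 2 :* (p :* e)) refl p a b c d e ⟩
  p ℕ.* a ℕ.+ p ℕ.* b ℕ.+ p ℕ.* c ℕ.+ p ℕ.* d ℕ.+ 2 ℕ.* (p ℕ.* e) ∎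
  where
  open ≡-Reasoning
  open +-*-Solver using (solve; _:+_; _:*_; _:=_; con)

∑-delta : (i : Fin n) (f : Fin n → ℕ) → ∑[ j < n ] (χ≡ i j ℕ.* f j) ≡ f i
∑-delta {ℕ.suc n} zero f =
  trans (cong (f zero ℕ.+ 0 ℕ.+_) (sum-replicate-zero n)) (trans (ℕP.+-identityʳ _) (ℕP.+-identityʳ _))
∑-delta {ℕ.suc n} (suc i) f = ∑-delta i (f ∘ suc)

χ≡-cong : {x y x′ y′ : Fin n} → (x ≡ y → x′ ≡ y′) → (x′ ≡ y′ → x ≡ y) → χ≡ x y ≡ χ≡ x′ y′
χ≡-cong {x = x} {y} {x′} {y′} to from = cong χ (does-⇔ (mk⇔ to from) (x Fin.≟ y) (x′ Fin.≟ y′))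

∑-delta-weighted : (p : ℕ) (i : Fin n) (f : Fin n → ℕ) → ∑[ j < n ] (p ℕ.* (χ≡ i j ℕ.* f j)) ≡ p ℕ.* f i
∑-delta-weighted {n} p i f = begin
  ∑[ j < n ] (p ℕ.* (χ≡ i j ℕ.* f j)) ≡⟨ sum-cong-≗ (λ j → *-x∙yz≈y∙xz p (χ≡ i j) (f j)) ⟩
  ∑[ j < n ] (χ≡ i j ℕ.* (p ℕ.* f j)) ≡⟨ ∑-delta i (λ j → p ℕ.* f j) ⟩
  p ℕ.* f i                           ∎
  where open ≡-Reasoning

∑₄ : ∀ k → (Fin k → Fin k → Fin k → Fin k → ℕ) → ℕ
∑₄ k F = ∑[ r < k ] ∑[ r′ < k ] ∑[ c < k ] ∑[ c′ < k ] F r r′ c c′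

module _ {k : ℕ} where

  ∑₄-cong : {F G : Fin k → Fin k → Fin k → Fin k → ℕ} → (∀ r r′ c c′ → F r r′ c c′ ≡ G r r′ c c′) → ∑₄ k F ≡ ∑₄ k G
  ∑₄-cong F≗G = sum-cong-≗ λ r → sum-cong-≗ λ r′ → sum-cong-≗ λ c → sum-cong-≗ λ c′ → F≗G r r′ c c′

  ∑₄-distrib-+ : (F G : Fin k → Fin k → Fin k → Fin k → ℕ) →
    ∑₄ k (λ r r′ c c′ → F r r′ c c′ ℕ.+ G r r′ c c′) ≡ ∑₄ k F ℕ.+ ∑₄ k G
  ∑₄-distrib-+ F G =
    trans (sum-cong-≗ λ r → trans (sum-cong-≗ λ r′ → trans (sum-cong-≗ λ c → ∑-distrib-+ (F r r′ c) (G r r′ c))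
                                                            (∑-distrib-+ (λ c → ∑[ c′ < k ] F r r′ c c′) (λ c → ∑[ c′ < k ] G r r′ c c′)))
                                  (∑-distrib-+ (λ r′ → ∑[ c < k ] ∑[ c′ < k ] F r r′ c c′) (λ r′ → ∑[ c < k ] ∑[ c′ < k ] G r r′ c c′)))
          (∑-distrib-+ (λ r → ∑[ r′ < k ] ∑[ c < k ] ∑[ c′ < k ] F r r′ c c′) (λ r → ∑[ r′ < k ] ∑[ c < k ] ∑[ c′ < k ] G r r′ c c′))

  ∑₄-*ˡ : (a : ℕ) (F : Fin k → Fin k → Fin k → Fin k → ℕ) → ∑₄ k (λ r r′ c c′ → a ℕ.* F r r′ c c′) ≡ a ℕ.* ∑₄ k F
  ∑₄-*ˡ a F = sym (trans (*-distribˡ-sum a (λ r → ∑[ r′ < k ] ∑[ c < k ] ∑[ c′ < k ] F r r′ c c′))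
                  (sum-cong-≗ λ r → trans (*-distribˡ-sum a (λ r′ → ∑[ c < k ] ∑[ c′ < k ] F r r′ c c′))
                  (sum-cong-≗ λ r′ → trans (*-distribˡ-sum a (λ c → ∑[ c′ < k ] F r r′ c c′))
                  (sum-cong-≗ λ c → *-distribˡ-sum a (F r r′ c)))))

  ∑₄-factor : (g : Fin k → Fin k → ℕ) (h : Fin k → Fin k → Fin k → Fin k → ℕ) →
    ∑₄ k (λ r r′ c c′ → g r r′ ℕ.* h r r′ c c′) ≡ ∑[ r < k ] ∑[ r′ < k ] (g r r′ ℕ.* ∑[ c < k ] ∑[ c′ < k ] h r r′ c c′)
  ∑₄-factor g h = sum-cong-≗ λ r → sum-cong-≗ λ r′ →
    sym (trans (*-distribˡ-sum (g r r′) (λ c → ∑[ c′ < k ] h r r′ c c′)) (sum-cong-≗ λ c → *-distribˡ-sum (g r r′) (h r r′ c)))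

  ∑₄-columns-outside : (F : Fin k → Fin k → Fin k → Fin k → ℕ) →
    ∑₄ k F ≡ ∑[ c < k ] ∑[ c′ < k ] ∑[ r < k ] ∑[ r′ < k ] F r r′ c c′
  ∑₄-columns-outside F = begin
    ∑₄ k F
      ≡⟨ sum-cong-≗ (λ r → ∑-comm (λ r′ c → ∑[ c′ < k ] F r r′ c c′)) ⟩
    ∑[ r < k ] ∑[ c < k ] ∑[ r′ < k ] ∑[ c′ < k ] F r r′ c c′
      ≡⟨ sum-cong-≗ (λ r → sum-cong-≗ λ c → ∑-comm (λ r′ c′ → F r r′ c c′)) ⟩
    ∑[ r < k ] ∑[ c < k ] ∑[ c′ < k ] ∑[ r′ < k ] F r r′ c c′
      ≡⟨ ∑-comm (λ r c → ∑[ c′ < k ] ∑[ r′ < k ] F r r′ c c′) ⟩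
    ∑[ c < k ] ∑[ r < k ] ∑[ c′ < k ] ∑[ r′ < k ] F r r′ c c′
      ≡⟨ sum-cong-≗ (λ c → ∑-comm (λ r c′ → ∑[ r′ < k ] F r r′ c c′)) ⟩
    ∑[ c < k ] ∑[ c′ < k ] ∑[ r < k ] ∑[ r′ < k ] F r r′ c c′ ∎
    where open ≡-Reasoning

  ∑₄-swap : (F : Fin k → Fin k → Fin k → Fin k → ℕ) → ∑₄ k F ≡ ∑₄ k (λ r r′ c c′ → F r′ r c′ c)
  ∑₄-swap F = begin
    ∑₄ k F
      ≡⟨ ∑-comm (λ r r′ → ∑[ c < k ] ∑[ c′ < k ] F r r′ c c′) ⟩
    ∑[ r′ < k ] ∑[ r < k ] ∑[ c < k ] ∑[ c′ < k ] F r r′ c c′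
      ≡⟨ sum-cong-≗ (λ r′ → sum-cong-≗ λ r → ∑-comm (λ c c′ → F r r′ c c′)) ⟩
    ∑₄ k (λ r r′ c c′ → F r′ r c′ c) ∎
    where open ≡-Reasoning

pairCount : ℕ → ℕ
pairCount k = ∑[ x < k ] ∑[ y < k ] χ< x y

pairSign : ℕ → ℤ
pairSign k = negOnePow (pairCount k ℕ.* pairCount k)

pairCount-injective : {ρ σ : Fin k → Fin k} → Injective _≡_ _≡_ ρ → Injective _≡_ _≡_ σ →
  ∑[ a < k ] ∑[ b < k ] χ< (σ b) (ρ a) ≡ pairCount k
pairCount-injective {k} {ρ} {σ} ρ-inj σ-inj = begin
  ∑[ a < k ] ∑[ b < k ] χ< (σ b) (ρ a) ≡⟨ sum-cong-≗ (λ a → ∑-injective σ-inj (λ y → χ< y (ρ a))) ⟩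
  ∑[ a < k ] ∑[ b < k ] χ< b (ρ a)     ≡⟨ ∑-injective ρ-inj (λ x → ∑[ b < k ] χ< b x) ⟩
  ∑[ a < k ] ∑[ b < k ] χ< b a         ≡⟨ ∑-comm {k} {k} (λ a b → χ< b a) ⟩
  pairCount k                          ∎
  where open ≡-Reasoning

∑₄-χ<-weighted : (h : Fin k → Fin k → Fin k → Fin k → ℕ) → (∀ x y → ∑[ a < k ] ∑[ b < k ] h x y a b ≡ pairCount k) →
  ∑₄ k (λ x y a b → χ< x y ℕ.* h x y a b) ≡ pairCount k ℕ.* pairCount k
∑₄-χ<-weighted {k} h h≡K = begin
  ∑₄ k (λ x y a b → χ< x y ℕ.* h x y a b)            ≡⟨ ∑₄-factor χ< h ⟩
  ∑[ x < k ] ∑[ y < k ] (χ< x y ℕ.* ∑[ a < k ] ∑[ b < k ] h x y a b)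
                                                      ≡⟨ sum-cong-≗ (λ x → sum-cong-≗ λ y → cong (χ< x y ℕ.*_) (h≡K x y)) ⟩
  ∑[ x < k ] ∑[ y < k ] (χ< x y ℕ.* pairCount k)      ≡⟨ trans (*-distribʳ-sum (pairCount k) (λ x → ∑[ y < k ] χ< x y))
                                                              (sum-cong-≗ {x = λ x → (∑[ y < k ] χ< x y) ℕ.* pairCount k} λ x → *-distribʳ-sum (pairCount k) (χ< x)) ⟨
  pairCount k ℕ.* pairCount k                          ∎
  where open ≡-Reasoning

rowInversions colInversions : Square k → ℕ
rowInversions {k} L = ∑[ i < k ] inversionCount (L i)
colInversions {k} L = ∑[ j < k ] inversionCount (λ i → L i j)

-- Double counting over pairs of cells (r, c), (r′, c′) with r < r′ (χ<-decomposition): pairs in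
-- one column give the column inversions of L, pairs with one value those of M, and the remaining
-- pairs are counted column by column (∑₄-crossing).
module RowInverse {k} (L M : Square k) (L-rows : ∀ r → Injective _≡_ _≡_ (L r)) (L∘M : ∀ r s → L r (M r s) ≡ s) where

  private
    M-rows : ∀ r → Injective _≡_ _≡_ (M r)
    M-rows r {s} {s′} eq = trans (sym (L∘M r s)) (trans (cong (L r) eq) (L∘M r s′))
    M∘L : ∀ r c → M r (L r c) ≡ c
    M∘L r c = L-rows r (L∘M r (L r c))
    open ≡-Reasoning

  columns-injective⁺ : (∀ c → Injective _≡_ _≡_ (λ r → L r c)) → ∀ s → Injective _≡_ _≡_ (λ r → M r s)
  columns-injective⁺ L-cols s {r} {r′} eq = L-cols (M r s) (trans (L∘M r s) (sym (trans (cong (L r′) eq) (L∘M r′ s))))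

  columns-injective⁻ : (∀ s → Injective _≡_ _≡_ (λ r → M r s)) → ∀ c → Injective _≡_ _≡_ (λ r → L r c)
  columns-injective⁻ M-cols c {r} {r′} eq = M-cols (L r c) (trans (M∘L r c) (sym (trans (cong (M r′) eq) (M∘L r′ c))))

  module _ (L-cols : ∀ c → Injective _≡_ _≡_ (λ r → L r c)) where

    private
      K = pairCount k

    ∑₄-column-pairs : ∑₄ k (λ r r′ c c′ → χ< r r′ ℕ.* χ< c′ c) ≡ K ℕ.* K
    ∑₄-column-pairs = ∑₄-χ<-weighted {k = k} (λ _ _ c c′ → χ< c′ c) (λ _ _ → ∑-comm {k} {k} (λ c c′ → χ< c′ c))

    ∑₄-value-pairs : ∑₄ k (λ r r′ c c′ → χ< r r′ ℕ.* χ< (L r′ c′) (L r c)) ≡ K ℕ.* K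
    ∑₄-value-pairs = ∑₄-χ<-weighted (λ r r′ c c′ → χ< (L r′ c′) (L r c)) (λ r r′ → pairCount-injective (L-rows r) (L-rows r′))

    ∑₄-same-column : ∑₄ k (λ r r′ c c′ → χ< r r′ ℕ.* (χ≡ c c′ ℕ.* χ< (L r′ c′) (L r c))) ≡ colInversions L
    ∑₄-same-column = begin
      ∑₄ k (λ r r′ c c′ → χ< r r′ ℕ.* (χ≡ c c′ ℕ.* χ< (L r′ c′) (L r c)))
        ≡⟨ sum-cong-≗ (λ r → sum-cong-≗ λ r′ → sum-cong-≗ λ c → ∑-delta-weighted (χ< r r′) c (λ c′ → χ< (L r′ c′) (L r c))) ⟩
      ∑[ r < k ] ∑[ r′ < k ] ∑[ c < k ] (χ< r r′ ℕ.* χ< (L r′ c) (L r c))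
        ≡⟨ sum-cong-≗ (λ r → ∑-comm (λ r′ c → χ< r r′ ℕ.* χ< (L r′ c) (L r c))) ⟩
      ∑[ r < k ] ∑[ c < k ] ∑[ r′ < k ] (χ< r r′ ℕ.* χ< (L r′ c) (L r c))
        ≡⟨ ∑-comm (λ r c → ∑[ r′ < k ] (χ< r r′ ℕ.* χ< (L r′ c) (L r c))) ⟩
      colInversions L ∎

    ∑₄-same-value : ∑₄ k (λ r r′ c c′ → χ< r r′ ℕ.* (χ≡ (L r c) (L r′ c′) ℕ.* χ< c′ c)) ≡ colInversions M
    ∑₄-same-value = begin
      ∑₄ k (λ r r′ c c′ → χ< r r′ ℕ.* (χ≡ (L r c) (L r′ c′) ℕ.* χ< c′ c))
        ≡⟨ sum-cong-≗ (λ r → sum-cong-≗ λ r′ → sum-cong-≗ λ c → trans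
             (sum-cong-≗ λ c′ → cong (λ e → χ< r r′ ℕ.* (e ℕ.* χ< c′ c)) (χ≡-cong (λ eq → trans (cong (M r′) eq) (M∘L r′ c′))
                                                                            (λ eq → trans (sym (L∘M r′ (L r c))) (cong (L r′) eq))))
             (∑-delta-weighted (χ< r r′) (M r′ (L r c)) (λ c′ → χ< c′ c))) ⟩
      ∑[ r < k ] ∑[ r′ < k ] ∑[ c < k ] (χ< r r′ ℕ.* χ< (M r′ (L r c)) c)
        ≡⟨ sum-cong-≗ (λ r → sum-cong-≗ λ r′ → trans (sym (∑-injective (M-rows r) (λ c → χ< r r′ ℕ.* χ< (M r′ (L r c)) c)))
             (sum-cong-≗ λ s → cong (λ t → χ< r r′ ℕ.* χ< (M r′ t) (M r s)) (L∘M r s))) ⟩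
      ∑[ r < k ] ∑[ r′ < k ] ∑[ s < k ] (χ< r r′ ℕ.* χ< (M r′ s) (M r s))
        ≡⟨ sum-cong-≗ (λ r → ∑-comm (λ r′ s → χ< r r′ ℕ.* χ< (M r′ s) (M r s))) ⟩
      ∑[ r < k ] ∑[ s < k ] ∑[ r′ < k ] (χ< r r′ ℕ.* χ< (M r′ s) (M r s))
        ≡⟨ ∑-comm (λ r s → ∑[ r′ < k ] (χ< r r′ ℕ.* χ< (M r′ s) (M r s))) ⟩
      colInversions M ∎

    private
      crossing : Fin k → Fin k → Fin k → Fin k → ℕ
      crossing r r′ c c′ = χ< c c′ ℕ.* χ< (L r′ c′) (L r c)

    ∑₄-same-row : ∑₄ k (λ r r′ c c′ → χ≡ r r′ ℕ.* crossing r r′ c c′) ≡ rowInversions L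
    ∑₄-same-row = trans (∑₄-factor χ≡ crossing)
      (sum-cong-≗ λ r → ∑-delta r (λ r′ → ∑[ c < k ] ∑[ c′ < k ] crossing r r′ c c′))

    ∑₄-crossing : ∑₄ k (λ r r′ c c′ → χ< r r′ ℕ.* (χ< c c′ ℕ.* χ< (L r′ c′) (L r c)))
                ℕ.+ ∑₄ k (λ r r′ c c′ → χ< r r′ ℕ.* (χ< c′ c ℕ.* χ< (L r c) (L r′ c′)))
                ℕ.+ rowInversions L ≡ K ℕ.* K
    ∑₄-crossing = begin
      ∑₄ k (λ r r′ c c′ → χ< r r′ ℕ.* crossing r r′ c c′)
        ℕ.+ ∑₄ k (λ r r′ c c′ → χ< r r′ ℕ.* (χ< c′ c ℕ.* χ< (L r c) (L r′ c′))) ℕ.+ rowInversions L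
        ≡⟨ cong₂ (λ a b → ∑₄ k (λ r r′ c c′ → χ< r r′ ℕ.* crossing r r′ c c′) ℕ.+ a ℕ.+ b)
                 (∑₄-swap (λ r r′ c c′ → χ< r r′ ℕ.* (χ< c′ c ℕ.* χ< (L r c) (L r′ c′)))) (sym ∑₄-same-row) ⟩
      ∑₄ k (λ r r′ c c′ → χ< r r′ ℕ.* crossing r r′ c c′) ℕ.+ ∑₄ k (λ r r′ c c′ → χ< r′ r ℕ.* crossing r r′ c c′)
        ℕ.+ ∑₄ k (λ r r′ c c′ → χ≡ r r′ ℕ.* crossing r r′ c c′)
        ≡⟨ trans (∑₄-distrib-+ {k} (λ r r′ c c′ → χ< r r′ ℕ.* crossing r r′ c c′ ℕ.+ χ< r′ r ℕ.* crossing r r′ c c′)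
                                 (λ r r′ c c′ → χ≡ r r′ ℕ.* crossing r r′ c c′))
                 (cong (ℕ._+ ∑₄ k (λ r r′ c c′ → χ≡ r r′ ℕ.* crossing r r′ c c′)) (∑₄-distrib-+ {k} (λ r r′ c c′ → χ< r r′ ℕ.* crossing r r′ c c′)
                                              (λ r r′ c c′ → χ< r′ r ℕ.* crossing r r′ c c′))) ⟨
      ∑₄ k (λ r r′ c c′ → χ< r r′ ℕ.* crossing r r′ c c′ ℕ.+ χ< r′ r ℕ.* crossing r r′ c c′ ℕ.+ χ≡ r r′ ℕ.* crossing r r′ c c′)
        ≡⟨ ∑₄-cong {k} (λ r r′ c c′ → weights-sum-to-one {χ< r r′} {χ< r′ r} {χ≡ r r′} (χ-trichotomy r r′) (crossing r r′ c c′)) ⟩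
      ∑₄ k crossing
        ≡⟨ ∑₄-columns-outside crossing ⟩
      ∑₄ k (λ c c′ r r′ → χ< c c′ ℕ.* χ< (L r′ c′) (L r c))
        ≡⟨ ∑₄-χ<-weighted (λ c c′ r r′ → χ< (L r′ c′) (L r c)) (λ c c′ → pairCount-injective (L-cols c) (L-cols c′)) ⟩
      K ℕ.* K ∎
      where
      weights-sum-to-one : ∀ {a b e} → a ℕ.+ b ℕ.+ e ≡ 1 → ∀ z → a ℕ.* z ℕ.+ b ℕ.* z ℕ.+ e ℕ.* z ≡ z
      weights-sum-to-one {a} {b} {e} a+b+e≡1 z = begin
        a ℕ.* z ℕ.+ b ℕ.* z ℕ.+ e ℕ.* z ≡⟨ cong (ℕ._+ e ℕ.* z) (ℕP.*-distribʳ-+ z a b) ⟨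
        (a ℕ.+ b) ℕ.* z ℕ.+ e ℕ.* z     ≡⟨ ℕP.*-distribʳ-+ z (a ℕ.+ b) e ⟨
        (a ℕ.+ b ℕ.+ e) ℕ.* z           ≡⟨ cong (ℕ._* z) a+b+e≡1 ⟩
        1 ℕ.* z                         ≡⟨ ℕP.*-identityˡ z ⟩
        z                               ∎

    doubleCrossings : ℕ
    doubleCrossings = ∑₄ k (λ r r′ c c′ → χ< r r′ ℕ.* (χ< c′ c ℕ.* χ< (L r′ c′) (L r c)))

    ∑₄-decomposition :
      ∑₄ k (λ r r′ c c′ → χ< r r′ ℕ.* χ< c′ c) ℕ.+ ∑₄ k (λ r r′ c c′ → χ< r r′ ℕ.* χ< (L r′ c′) (L r c))
        ≡ ∑₄ k (λ r r′ c c′ → χ< r r′ ℕ.* (χ≡ c c′ ℕ.* χ< (L r′ c′) (L r c)))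
          ℕ.+ ∑₄ k (λ r r′ c c′ → χ< r r′ ℕ.* (χ≡ (L r c) (L r′ c′) ℕ.* χ< c′ c))
          ℕ.+ ∑₄ k (λ r r′ c c′ → χ< r r′ ℕ.* (χ< c c′ ℕ.* χ< (L r′ c′) (L r c)))
          ℕ.+ ∑₄ k (λ r r′ c c′ → χ< r r′ ℕ.* (χ< c′ c ℕ.* χ< (L r c) (L r′ c′)))
          ℕ.+ 2 ℕ.* doubleCrossings
    ∑₄-decomposition = begin
      ∑₄ k P ℕ.+ ∑₄ k Q                                         ≡⟨ ∑₄-distrib-+ P Q ⟨
      ∑₄ k (λ r r′ c c′ → P r r′ c c′ ℕ.+ Q r r′ c c′)          ≡⟨ ∑₄-cong scaled-decomposition ⟩
      ∑₄ k (λ r r′ c c′ → T₁ r r′ c c′ ℕ.+ T₂ r r′ c c′ ℕ.+ T₃ r r′ c c′ ℕ.+ T₄ r r′ c c′ ℕ.+ 2 ℕ.* X r r′ c c′)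
        ≡⟨ ∑₄-distrib-+ (λ r r′ c c′ → T₁ r r′ c c′ ℕ.+ T₂ r r′ c c′ ℕ.+ T₃ r r′ c c′ ℕ.+ T₄ r r′ c c′) (λ r r′ c c′ → 2 ℕ.* X r r′ c c′) ⟩
      ∑₄ k (λ r r′ c c′ → T₁ r r′ c c′ ℕ.+ T₂ r r′ c c′ ℕ.+ T₃ r r′ c c′ ℕ.+ T₄ r r′ c c′) ℕ.+ ∑₄ k (λ r r′ c c′ → 2 ℕ.* X r r′ c c′)
        ≡⟨ cong₂ ℕ._+_ (trans (∑₄-distrib-+ (λ r r′ c c′ → T₁ r r′ c c′ ℕ.+ T₂ r r′ c c′ ℕ.+ T₃ r r′ c c′) T₄)
                              (cong (ℕ._+ ∑₄ k T₄) (trans (∑₄-distrib-+ (λ r r′ c c′ → T₁ r r′ c c′ ℕ.+ T₂ r r′ c c′) T₃)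
                                                          (cong (ℕ._+ ∑₄ k T₃) (∑₄-distrib-+ T₁ T₂)))))
                       (∑₄-*ˡ 2 X) ⟩
      ∑₄ k T₁ ℕ.+ ∑₄ k T₂ ℕ.+ ∑₄ k T₃ ℕ.+ ∑₄ k T₄ ℕ.+ 2 ℕ.* ∑₄ k X ∎
      where
      P Q T₁ T₂ T₃ T₄ X : Fin k → Fin k → Fin k → Fin k → ℕ
      P  r r′ c c′ = χ< r r′ ℕ.* χ< c′ c
      Q  r r′ c c′ = χ< r r′ ℕ.* χ< (L r′ c′) (L r c)
      T₁ r r′ c c′ = χ< r r′ ℕ.* (χ≡ c c′ ℕ.* χ< (L r′ c′) (L r c))
      T₂ r r′ c c′ = χ< r r′ ℕ.* (χ≡ (L r c) (L r′ c′) ℕ.* χ< c′ c)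
      T₃ r r′ c c′ = χ< r r′ ℕ.* (χ< c c′ ℕ.* χ< (L r′ c′) (L r c))
      T₄ r r′ c c′ = χ< r r′ ℕ.* (χ< c′ c ℕ.* χ< (L r c) (L r′ c′))
      X  r r′ c c′ = χ< r r′ ℕ.* (χ< c′ c ℕ.* χ< (L r′ c′) (L r c))
      scaled-decomposition : ∀ r r′ c c′ → P r r′ c c′ ℕ.+ Q r r′ c c′
        ≡ T₁ r r′ c c′ ℕ.+ T₂ r r′ c c′ ℕ.+ T₃ r r′ c c′ ℕ.+ T₄ r r′ c c′ ℕ.+ 2 ℕ.* X r r′ c c′
      scaled-decomposition r r′ c c′ = *-distribˡ-identity (χ< r r′) (χ< c′ c) (χ< v′ v) (χ≡ c c′ ℕ.* χ< v′ v) (χ≡ v v′ ℕ.* χ< c′ c)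
        (χ< c c′ ℕ.* χ< v′ v) (χ< c′ c ℕ.* χ< v v′) (χ< c′ c ℕ.* χ< v′ v) (χ<-decomposition c c′ v v′)
        where
        v = L r c
        v′ = L r′ c′

    inversion-identity : K ℕ.* K ℕ.+ rowInversions L ≡ colInversions L ℕ.+ colInversions M ℕ.+ 2 ℕ.* doubleCrossings
    inversion-identity = ℕP.+-cancelˡ-≡ (K ℕ.* K) _ _ $ begin
      K ℕ.* K ℕ.+ (K ℕ.* K ℕ.+ rowInversions L)
        ≡⟨ ℕP.+-assoc (K ℕ.* K) (K ℕ.* K) (rowInversions L) ⟨
      K ℕ.* K ℕ.+ K ℕ.* K ℕ.+ rowInversions L
        ≡⟨ cong (ℕ._+ rowInversions L) (cong₂ ℕ._+_ (sym ∑₄-column-pairs) (sym ∑₄-value-pairs)) ⟩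
      ∑₄ k (λ r r′ c c′ → χ< r r′ ℕ.* χ< c′ c) ℕ.+ ∑₄ k (λ r r′ c c′ → χ< r r′ ℕ.* χ< (L r′ c′) (L r c)) ℕ.+ rowInversions L
        ≡⟨ cong (ℕ._+ rowInversions L) ∑₄-decomposition ⟩
      same-column ℕ.+ same-value ℕ.+ E₁ ℕ.+ E₂ ℕ.+ 2 ℕ.* doubleCrossings ℕ.+ rowInversions L
        ≡⟨ cong₂ (λ a b → a ℕ.+ b ℕ.+ E₁ ℕ.+ E₂ ℕ.+ 2 ℕ.* doubleCrossings ℕ.+ rowInversions L) ∑₄-same-column ∑₄-same-value ⟩
      colInversions L ℕ.+ colInversions M ℕ.+ E₁ ℕ.+ E₂ ℕ.+ 2 ℕ.* doubleCrossings ℕ.+ rowInversions L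
        ≡⟨ solve 6 (λ a b e₁ e₂ x r → a :+ b :+ e₁ :+ e₂ :+ x :+ r := e₁ :+ e₂ :+ r :+ (a :+ b :+ x)) refl
                 (colInversions L) (colInversions M) E₁ E₂ (2 ℕ.* doubleCrossings) (rowInversions L) ⟩
      E₁ ℕ.+ E₂ ℕ.+ rowInversions L ℕ.+ (colInversions L ℕ.+ colInversions M ℕ.+ 2 ℕ.* doubleCrossings)
        ≡⟨ cong (ℕ._+ (colInversions L ℕ.+ colInversions M ℕ.+ 2 ℕ.* doubleCrossings)) ∑₄-crossing ⟩
      K ℕ.* K ℕ.+ (colInversions L ℕ.+ colInversions M ℕ.+ 2 ℕ.* doubleCrossings) ∎
      where
      open +-*-Solver using (solve; _:+_; _:=_)
      same-column = ∑₄ k (λ r r′ c c′ → χ< r r′ ℕ.* (χ≡ c c′ ℕ.* χ< (L r′ c′) (L r c)))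
      same-value = ∑₄ k (λ r r′ c c′ → χ< r r′ ℕ.* (χ≡ (L r c) (L r′ c′) ℕ.* χ< c′ c))
      E₁ = ∑₄ k (λ r r′ c c′ → χ< r r′ ℕ.* (χ< c c′ ℕ.* χ< (L r′ c′) (L r c)))
      E₂ = ∑₄ k (λ r r′ c c′ → χ< r r′ ℕ.* (χ< c′ c ℕ.* χ< (L r c) (L r′ c′)))

    negOnePow-colInversions : negOnePow (colInversions M)
      ≡ pairSign k ℤ.* (negOnePow (rowInversions L) ℤ.* negOnePow (colInversions L))
    negOnePow-colInversions = begin
      d                   ≡⟨ ℤP.*-identityˡ d ⟨
      + 1 ℤ.* d           ≡⟨ cong (ℤ._* d) (negOnePow-square (colInversions L)) ⟨
      c ℤ.* c ℤ.* d       ≡⟨ ℤP.*-assoc c c d ⟩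
      c ℤ.* (c ℤ.* d)     ≡⟨ ℤP.*-comm c (c ℤ.* d) ⟩
      c ℤ.* d ℤ.* c       ≡⟨ cong (ℤ._* c) signs ⟨
      a ℤ.* b ℤ.* c       ≡⟨ ℤP.*-assoc a b c ⟩
      a ℤ.* (b ℤ.* c)     ∎
      where
      a = negOnePow (K ℕ.* K)
      b = negOnePow (rowInversions L)
      c = negOnePow (colInversions L)
      d = negOnePow (colInversions M)
      x = doubleCrossings
      signs : a ℤ.* b ≡ c ℤ.* d
      signs = begin
        a ℤ.* b                                                    ≡⟨ negOnePow-+ (K ℕ.* K) (rowInversions L) ⟨
        negOnePow (K ℕ.* K ℕ.+ rowInversions L)                    ≡⟨ cong negOnePow inversion-identity ⟩
        negOnePow (colInversions L ℕ.+ colInversions M ℕ.+ 2 ℕ.* x) ≡⟨ negOnePow-+ (colInversions L ℕ.+ colInversions M) (2 ℕ.* x) ⟩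
        negOnePow (colInversions L ℕ.+ colInversions M) ℤ.* negOnePow (2 ℕ.* x)
          ≡⟨ cong₂ ℤ._*_ (negOnePow-+ (colInversions L) (colInversions M)) (negOnePow-double x) ⟩
        c ℤ.* d ℤ.* + 1                                             ≡⟨ ℤP.*-identityʳ (c ℤ.* d) ⟩
        c ℤ.* d                                                     ∎

-- Latin squares

rowsArePermutationsB colsArePermutationsB : Square k → Bool
rowsArePermutationsB {k} L = allB (λ i → isPermutationB (L i)) (allFin k)
colsArePermutationsB {k} L = allB (λ j → isPermutationB (λ i → L i j)) (allFin k)

rowsSign-if : (L : Square k) → rowsSign k L ≡ (if rowsArePermutationsB L then negOnePow (rowInversions L) else + 0)
rowsSign-if {k} L = trans (prodℤ-cong (λ i → sgnSeq-allFin (L i)) (allFin k))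
                          (prodℤ-signs (λ i → isPermutationB (L i)) (λ i → inversionCount (L i)))

colsSign-if : (L : Square k) → colsSign k L ≡ (if colsArePermutationsB L then negOnePow (colInversions L) else + 0)
colsSign-if {k} L = trans (prodℤ-cong (λ j → sgnSeq-allFin (λ i → L i j)) (allFin k))
                          (prodℤ-signs (λ j → isPermutationB (λ i → L i j)) (λ j → inversionCount (λ i → L i j)))

rowsArePermutationsB⇒injective : (L : Square k) → rowsArePermutationsB L ≡ true → ∀ r → Injective _≡_ _≡_ (L r)
rowsArePermutationsB⇒injective L rows r = distinctB⇒injective (L r) (allB-allFin⁻ _ rows r)

colsArePermutationsB⇒injective : (L : Square k) → colsArePermutationsB L ≡ true → ∀ c → Injective _≡_ _≡_ (λ r → L r c)
colsArePermutationsB⇒injective L cols c = distinctB⇒injective (λ r → L r c) (allB-allFin⁻ _ cols c)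

injective⇒colsArePermutationsB : (L : Square k) → (∀ c → Injective _≡_ _≡_ (λ r → L r c)) → colsArePermutationsB L ≡ true
injective⇒colsArePermutationsB L cols = allB-allFin⁺ _ (λ c → injective⇒distinctB (λ r → L r c) (cols c))

invertRows : Square k → Square k
invertRows L i = invertRow (L i)

invertRows-inverse : ∀ k → Inverse (DecSetoid.setoid (Pointwise.decSetoid (Pointwise.decSetoid (≡-decSetoid k) k) k))
                                   (DecSetoid.setoid (Pointwise.decSetoid (Pointwise.decSetoid (≡-decSetoid k) k) k))
invertRows-inverse k = strictInverse invertRows invertRows
  (λ L≋L′ i → invertRow-cong (L≋L′ i)) (λ L≋L′ i → invertRow-cong (L≋L′ i))
  (λ L i → invertRow-involutive (L i)) (λ L i → invertRow-involutive (L i))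

module _ (L : Square k) (rows : rowsArePermutationsB L ≡ true) where

  private
    L-rows = rowsArePermutationsB⇒injective L rows

  invertRows-rightInverse : ∀ r s → L r (invertRows L r s) ≡ s
  invertRows-rightInverse r s =
    trans (cong (L r) (invertRow-permutation (allB-allFin⁻ _ rows r) s)) (preimage-inverseˡ (L-rows r) s)

  open RowInverse L (invertRows L) L-rows invertRows-rightInverse

  colsArePermutationsB-invertRows : colsArePermutationsB (invertRows L) ≡ colsArePermutationsB L
  colsArePermutationsB-invertRows = bool-≡
    (λ cols → injective⇒colsArePermutationsB L (columns-injective⁻ (colsArePermutationsB⇒injective (invertRows L) cols)))
    (λ cols → injective⇒colsArePermutationsB (invertRows L) (columns-injective⁺ (colsArePermutationsB⇒injective L cols)))

rowsArePermutationsB-invertRows : (L : Square k) → rowsArePermutationsB (invertRows L) ≡ rowsArePermutationsB L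
rowsArePermutationsB-invertRows {k} L = allB-cong (λ i → isPermutationB-invertRow (L i)) (allFin k)

rowsSign-nonpermutation : (L : Square k) → rowsArePermutationsB L ≡ false → rowsSign k L ≡ + 0
rowsSign-nonpermutation L rows rewrite rowsSign-if L | rows = refl

rowsSign-square : (L : Square k) → rowsArePermutationsB L ≡ true → rowsSign k L ℤ.* rowsSign k L ≡ + 1
rowsSign-square L rows rewrite rowsSign-if L | rows = negOnePow-square (rowInversions L)

colsSign-invertRows : (L : Square k) → rowsArePermutationsB L ≡ true →
  colsSign k (invertRows L) ≡ pairSign k ℤ.* (rowsSign k L ℤ.* colsSign k L)
colsSign-invertRows {k} L rows
  rewrite colsSign-if (invertRows L) | colsArePermutationsB-invertRows L rows | rowsSign-if L | rows | colsSign-if L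
  with colsArePermutationsB L in cols
... | false = sym (trans (cong (ℤ._*_ (pairSign k)) (ℤP.*-zeroʳ (negOnePow (rowInversions L)))) (ℤP.*-zeroʳ (pairSign k)))
... | true = negOnePow-colInversions (colsArePermutationsB⇒injective L cols)
  where open RowInverse L (invertRows L) (rowsArePermutationsB⇒injective L rows) (invertRows-rightInverse L rows)

sign-invertRows : (L : Square k) →
  rowsSign k (invertRows L) ℤ.* rowsSign k (invertRows L) ℤ.* colsSign k (invertRows L)
    ≡ pairSign k ℤ.* latinSign k L
sign-invertRows {k} L with rowsArePermutationsB L in rows
... | true = begin
  rowsSign k (invertRows L) ℤ.* rowsSign k (invertRows L) ℤ.* colsSign k (invertRows L)
    ≡⟨ cong (ℤ._* colsSign k (invertRows L)) (rowsSign-square (invertRows L) (trans (rowsArePermutationsB-invertRows L) rows)) ⟩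
  + 1 ℤ.* colsSign k (invertRows L)
    ≡⟨ ℤP.*-identityˡ _ ⟩
  colsSign k (invertRows L)
    ≡⟨ colsSign-invertRows L rows ⟩
  pairSign k ℤ.* latinSign k L ∎
  where open ≡-Reasoning
... | false
  rewrite rowsSign-nonpermutation (invertRows L) (trans (rowsArePermutationsB-invertRows L) rows)
        | rowsSign-nonpermutation L rows = sym (ℤP.*-zeroʳ (pairSign k))

latinSign-isLatinB : (L : Square k) → 𝟙 (isLatinB k L) ℤ.* latinSign k L ≡ latinSign k L
latinSign-isLatinB {k} L rewrite rowsSign-if L | colsSign-if L
  with rowsArePermutationsB L | colsArePermutationsB L
... | true  | true  = ℤP.*-identityˡ _
... | true  | false = sym (ℤP.*-zeroʳ (negOnePow (rowInversions L)))
... | false | _     = refl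

AT-sum : ∀ k → AT k ≡ sumℤ (map (latinSign k) (allFns k (allFns k (allFin k))))
AT-sum k = trans (sumℤ-filter-true (isLatinB k) (latinSign k) (allFns k (allFns k (allFin k))))
                 (sumℤ-cong latinSign-isLatinB (allFns k (allFns k (allFin k))))

Δ-tableT-AT : ∀ q k → let d = ℕ.suc (ℕ.suc q ℕ.* 2) in
  Δ k (tableT d k) (unitTensor d k) ≡ pairSign k ℤ.* AT k
Δ-tableT-AT q k = begin
  Δ k (tableT d k) (unitTensor d k)
    ≡⟨ Δ-tableT q k ⟩
  sumℤ (map G squares)
    ≡⟨ sum-reindex (squareEnumeration k) (squareEnumeration k) (invertRows-inverse k) G-cong ⟨
  sumℤ (map (G ∘ invertRows) squares)
    ≡⟨ sumℤ-cong sign-invertRows squares ⟩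
  sumℤ (map (λ L → pairSign k ℤ.* latinSign k L) squares)
    ≡⟨ sumℤ-*ˡ (pairSign k) (latinSign k) squares ⟩
  pairSign k ℤ.* sumℤ (map (latinSign k) squares)
    ≡⟨ cong (pairSign k ℤ.*_) (AT-sum k) ⟨
  pairSign k ℤ.* AT k ∎
  where
  open ≡-Reasoning
  d = ℕ.suc (ℕ.suc q ℕ.* 2)
  squares = allFns k (allFns k (allFin k))
  G : Square k → ℤ
  G L = rowsSign k L ℤ.* rowsSign k L ℤ.* colsSign k L
  G-cong : ∀ {L L′} → (∀ i j → L i j ≡ L′ i j) → G L ≡ G L′
  G-cong L≋L′ = cong₂ (λ r c → r ℤ.* r ℤ.* c) (rowsSign-cong k L≋L′) (colsSign-cong k L≋L′)

odd⇒suc-double : ∀ d → ¬ (2 ∣ d) → ∃ λ m → d ≡ ℕ.suc (m ℕ.* 2)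
odd⇒suc-double ℕ.zero 2∤d = ⊥-elim (2∤d (2 ∣0))
odd⇒suc-double (ℕ.suc ℕ.zero) _ = 0 , refl
odd⇒suc-double (ℕ.suc (ℕ.suc d)) 2∤d with odd⇒suc-double d (2∤d ∘ ∣m∣n⇒∣m+n ∣-refl)
... | m , refl = ℕ.suc m , refl

proposition7p1 : (d k : ℕ) → d ≥ 3 → ¬ (2 ∣ d) → 2 ∣ k →
    ((Δ k (tableT d k) (unitTensor d k) ≢ + 0 → AT k ≢ + 0)
    × (AT k ≢ + 0 → Δ k (tableT d k) (unitTensor d k) ≢ + 0))
proposition7p1 d k d≥3 2∤d _ with odd⇒suc-double d 2∤d | d≥3
... | ℕ.zero  , refl | ℕ.s≤s ()
... | ℕ.suc q , refl | _ = (λ Δ≢0 AT≡0 → Δ≢0 (AT≡0⇒Δ≡0 AT≡0)) , (λ AT≢0 Δ≡0 → AT≢0 (Δ≡0⇒AT≡0 Δ≡0))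
  where
  AT≡0⇒Δ≡0 : AT k ≡ + 0 → Δ k (tableT d k) (unitTensor d k) ≡ + 0
  AT≡0⇒Δ≡0 AT≡0 = trans (Δ-tableT-AT q k) (trans (cong (pairSign k ℤ.*_) AT≡0) (ℤP.*-zeroʳ (pairSign k)))
  Δ≡0⇒AT≡0 : Δ k (tableT d k) (unitTensor d k) ≡ + 0 → AT k ≡ + 0
  Δ≡0⇒AT≡0 Δ≡0 = [ ⊥-elim ∘ negOnePow≢0 (pairCount k ℕ.* pairCount k) , id ]′
                    (ℤP.i*j≡0⇒i≡0∨j≡0 (pairSign k) (trans (sym (Δ-tableT-AT q k)) Δ≡0))
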